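{- Let $n\ge 2$ and $m\ge 2$ be integers. Let $\phi:\widetilde A_{n-1}\to \widetilde A_{mn-1}$ be the homomorphism given by $\phi(r_i)=\prod_{j=0}^{m-1}s_{i+jn}$ for $0\le i\le n-1$, and let $\ell$ be the length function of $\widetilde A_{mn-1}$. Then $$U^{\widetilde A_{mn-1}}_{\widetilde A_{n-1}}(q):=\sum_{w\in \widetilde A_{n-1}}q^{\ell(\phi(w))}=\prod_{k=1}^{n}[k]_{q^m}\cdot\prod_{k=2}^{n}\frac{1}{1-q^{(k-1)m}}.$$
   Context: $[k]_q:=1+q+\cdots+q^{k-1}$. For $N\ge 3$, the affine Coxeter group $\widetilde A_{N-1}$ is generated by $s_0,\dots,s_{N-1}$ (indices modulo $N$) with $s_i^2=e$, $(s_is_{i+1})^3=e$ and $(s_is_j)^2=e$ when $j\not\equiv i,i\pm1 \pmod N$; $\widetilde A_1$ is the infinite dihedral group generated by two involutions $r_0,r_1$ with no further relation. Here $\widetilde A_{n-1}$ has generators $r_0,\dots,r_{n-1}$ and $\widetilde A_{mn-1}$ has generators $s_0,\dots,s_{mn-1}$ (indices mod $mn$); the factors in $\phi(r_i)$ commute, and the assignment extends to an injective group homomorphism. -}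

module Defs where

open import Data.Nat using (ℕ; zero; suc; _+_; _*_; _∸_; _≤_; _≡ᵇ_; pred)
open import Data.Bool using (if_then_else_)
open import Data.Fin using (Fin; toℕ; combine)
open import Data.List using (List; []; _∷_; _++_; length; map; concatMap; allFin; upTo; foldr)
open import Data.Nat.ListAction using (sum)
open import Data.List.Relation.Unary.All using (All)
open import Data.List.Relation.Unary.Any using (Any)
open import Data.List.Relation.Unary.AllPairs using (AllPairs)
open import Data.Product using (Σ; _×_)
open import Data.Sum using (_⊎_)
open import Relation.Binary.PropositionalEquality using (_≡_; _≢_)
open import Relation.Nullary using (¬_)

-- The affine Coxeter group Ã_{N-1}, presented on generators s_0..s_{N-1}
-- (words = List (Fin N)), as the quotient of the free monoid on the
-- involutive generators by the Coxeter relations.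

Adj : {N : ℕ} → Fin N → Fin N → Set
Adj {N} i j = (toℕ j ≡ suc (toℕ i)) ⊎ ((suc (toℕ i) ≡ N) × (toℕ j ≡ 0))

data Relator (N : ℕ) : List (Fin N) → Set where
  sq    : (i : Fin N) → Relator N (i ∷ i ∷ [])
  braid : 3 ≤ N → (i j : Fin N) → Adj i j →
          Relator N (i ∷ j ∷ i ∷ j ∷ i ∷ j ∷ [])
  comm  : (i j : Fin N) → i ≢ j → ¬ Adj i j → ¬ Adj j i →
          Relator N (i ∷ j ∷ i ∷ j ∷ [])

data _~_ {N : ℕ} : List (Fin N) → List (Fin N) → Set where
  ~refl  : ∀ {u} → u ~ u
  ~sym   : ∀ {u v} → u ~ v → v ~ u
  ~trans : ∀ {u v w} → u ~ v → v ~ w → u ~ w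
  ~rel   : ∀ {r} → Relator N r → (u v : List (Fin N)) → (u ++ (r ++ v)) ~ (u ++ v)

IsLength : (N : ℕ) → List (Fin N) → ℕ → Set
IsLength N x k =
  (Σ (List (Fin N)) λ w → (w ~ x) × (length w ≡ k)) ×
  ((w : List (Fin N)) → w ~ x → k ≤ length w)

-- φ(r_i) = s_i s_{i+n} ... s_{i+(m-1)n}; extended to words.
-- combine j i : Fin (m * n) has value j * n + i.
φ : (n m : ℕ) → List (Fin n) → List (Fin (m * n))
φ n m = concatMap (λ i → map (λ j → combine j i) (allFin m))

HasCount : {N : ℕ} → (List (Fin N) → Set) → ℕ → Set
HasCount {N} P c =
  Σ (List (List (Fin N))) λ L →
    (length L ≡ c) × All P L × AllPairs (λ u v → ¬ (u ~ v)) L ×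
    ((w : List (Fin N)) → P w → Any (λ v → w ~ v) L)

Series : Set
Series = ℕ → ℕ

mono : ℕ → Series
mono e d = if e ≡ᵇ d then 1 else 0

one : Series
one = mono 0

_⋆_ : Series → Series → Series
(f ⋆ g) d = sum (map (λ t → f t * g (d ∸ t)) (upTo (suc d)))

bracket : ℕ → ℕ → Series
bracket m k d = sum (map (λ t → mono (t * m) d) (upTo k))

-- 1 / (1 - q^a) = Σ_{t ≥ 0} q^{t a}   (used only with a ≥ 1)
geo : ℕ → Series
geo a d = sum (map (λ t → mono (t * a) d) (upTo (suc d)))

prodS : List Series → Series
prodS = foldr _⋆_ one

RHS : ℕ → ℕ → Series
RHS n m =
  prodS (map (λ t → bracket m (suc t)) (upTo n)) ⋆
  prodS (map (λ t → geo (t * m)) (Data.List.drop 1 (upTo n)))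

{-# OPTIONS --safe #-}
module Submission where

-- An element w of Ã_{N-1} is recorded by its code, the affine inversion table a ∈ ℕ^N
-- (entries indexed mod N), on which s_i acts through the pair (a_i, a_{i+1}) alone.
-- This action respects the Coxeter relations, the code of every word has a zero entry,
-- and peeling off descents turns each code a with a zero into a word NF a of length Σ a
-- whose code is a. Descents are confluent (distant ones commute, adjacent ones braid),
-- so w ~ NF (code w): codes with a zero classify group elements, and ℓ = Σ ∘ code.
-- The letters s_{i+jn} (j < m) of φ(r_i) act on disjoint pairs of positions, each doing
-- to one copy of the m-fold repeated code of w what s_i does to it; hence ℓ(φ w) = m ℓ(w).
--
-- It remains to count codes with a zero by Σ a. Cutting a at its first zero gives (p, x)
-- with p < n, x ∈ ℕ^{n-1} and Σ a = p + Σ x; writing x_k = e_k + g_k (k+1) with e_k ≤ k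
-- identifies such codes with the choices of one monomial from each factor [k]_{q^m} and
-- 1/(1 - q^{km}) of the product, q^{m Σ a} being the product of the chosen monomials.

open import Defs
open import Data.Nat using (ℕ; zero; suc; pred; _+_; _*_; _∸_; _≤_; _<_; _≤?_; _<?_; z≤n; s≤s; NonZero; >-nonZero)
open import Data.Nat.Properties hiding (_≟_)
open import Data.Nat.Properties using () renaming (_≟_ to _≟ℕ_)
open import Data.Nat.DivMod
  using (_%_; _/_; _mod_; m%n%n≡m%n; %-distribˡ-+; [m+n]%n≡m%n; [m+kn]%n≡m%n; m<n⇒m%n≡m; n%n≡0;
         m≡m%n+[m/n]*n; m%n<n; m∣n⇒o%n%m≡o%m; +-distrib-/-∣ʳ; m<n⇒m/n≡0; m*n/n≡m)
open import Data.Nat.Divisibility using (divides; ∣⇒≤; n∣m*n)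
open import Data.Nat.Induction using (<-wellFounded)
open import Data.Nat.ListAction using (sum)
open import Data.Nat.Tactic.RingSolver using (solve-∀)
open import Data.Fin as Fin using (Fin; toℕ; combine; remainder; quotient)
open import Data.Fin.Properties
  using (_≟_; any?; toℕ-fromℕ<; toℕ-injective; toℕ<n; toℕ-combine; combine-remQuot; remQuot-combine;
         combine-injectiveˡ)
open import Data.Vec as V using (Vec; lookup; toList; _[_]≔_)
open import Data.Vec.Properties
  using (lookup∘update; lookup∘update′; []≔-commutes; []≔-idempotent; []≔-lookup; lookup-replicate;
         lookup-++ˡ; lookup-++ʳ; length-toList)
import Data.Vec.Properties as V
open import Data.Vec.Relation.Binary.Pointwise.Extensional using (ext; Pointwise-≡⇒≡)
open import Data.Vec.Membership.Propositional using () renaming (_∈_ to _∈ᵥ_)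
open import Data.Vec.Membership.Propositional.Properties using (∈-lookup; ∈-toList⁺; ∈-toList⁻)
import Data.Vec.Relation.Unary.Any as VecAny
import Data.Vec.Relation.Unary.Any.Properties as VecAny
open import Data.List
  using (List; []; _∷_; _++_; [_]; _∷ʳ_; length; map; concatMap; cartesianProduct; upTo; allFin; filter;
         zipWith)
open import Data.List.Properties
  using (++-assoc; ++-identityʳ; length-++; length-map; map-cong; filter-accept; filter-reject;
         upTo-∷ʳ; map-applyUpTo; map-upTo; length-upTo)
open import Data.List.Relation.Unary.All as All using (All; []; _∷_)
import Data.List.Relation.Unary.All.Properties as All
open import Data.List.Relation.Unary.AllPairs as AllPairs using (AllPairs; []; _∷_)
import Data.List.Relation.Unary.AllPairs.Properties as AllPairs
open import Data.List.Relation.Unary.Any as Any using (Any; here; there)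
import Data.List.Relation.Unary.Any.Properties as Any
open import Data.List.Relation.Unary.Unique.Propositional using (Unique)
import Data.List.Relation.Unary.Unique.Propositional.Properties as Unique
open import Data.List.Relation.Binary.Pointwise as Pointwise using (Pointwise; []; _∷_)
open import Data.List.Membership.Propositional using (_∈_; find; lose)
open import Data.List.Membership.Propositional.Properties
  using (∈-map⁺; ∈-map⁻; ∈-allFin; ∈-filter⁺; ∈-filter⁻; ∈-concatMap⁺; ∈-concatMap⁻;
         ∈-cartesianProduct⁺; ∈-cartesianProduct⁻; ∈-upTo⁺; ∈-upTo⁻)
open import Data.Product using (_×_; _,_; proj₁; proj₂; ∃; ∃₂; uncurry)
open import Data.Sum using (_⊎_; inj₁; inj₂)
open import Data.Unit using (⊤; tt)
open import Function using (_∘_)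
open import Induction.WellFounded using (Acc; acc)
open import Relation.Nullary using (¬_; Dec; yes; no; contradiction)
open import Relation.Nullary.Decidable using (map′)
open import Relation.Binary.Bundles using (Setoid)
import Relation.Binary.Reasoning.Setoid as SetoidReasoning
open import Relation.Binary.PropositionalEquality hiding ([_])

-- s_i acting on the entries (a_i, a_{i+1}) of a code: the length goes up by one when
-- a_i ≤ a_{i+1} and down by one otherwise. Here and for `next` and `act` below, opacity
-- keeps unification from unfolding nested actions, which is prohibitively expensive.
opaque
  exchange : ℕ → ℕ → ℕ × ℕ
  exchange x y with x ≤? y
  ... | yes _ = suc y , x
  ... | no  _ = y , pred x

  exchange-≤ : ∀ {x y} → x ≤ y → exchange x y ≡ (suc y , x)
  exchange-≤ {x} {y} x≤y with x ≤? y
  ... | yes _   = refl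
  ... | no  x≰y = contradiction x≤y x≰y

  exchange-> : ∀ {x y} → y < x → exchange x y ≡ (y , pred x)
  exchange-> {x} {y} y<x with x ≤? y
  ... | yes x≤y = contradiction x≤y (<⇒≱ y<x)
  ... | no  _   = refl

exchange-involutive : ∀ x y → uncurry exchange (exchange x y) ≡ (x , y)
exchange-involutive x y with ≤-<-connex x y
... | inj₁ x≤y rewrite exchange-≤ x≤y | exchange-> (s≤s x≤y) = refl
exchange-involutive (suc x) y | inj₂ (s≤s y≤x) rewrite exchange-> (s≤s y≤x) | exchange-≤ y≤x = refl

Triple : Set
Triple = ℕ × ℕ × ℕ

exchange₁₂ exchange₂₃ : Triple → Triple
exchange₁₂ (x , y , z) = proj₁ (exchange x y) , proj₂ (exchange x y) , z
exchange₂₃ (x , y , z) = x , exchange y z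

private
  exchange-232 : ∀ {x y z a₁ b₁ a₂ b₂ a₃ b₃} →
    exchange y z ≡ (a₁ , b₁) → exchange x a₁ ≡ (a₂ , b₂) → exchange b₂ b₁ ≡ (a₃ , b₃) →
    exchange₂₃ (exchange₁₂ (exchange₂₃ (x , y , z))) ≡ (a₂ , a₃ , b₃)
  exchange-232 e₁ e₂ e₃ rewrite e₁ | e₂ | e₃ = refl

  exchange-121 : ∀ {x y z a₁ b₁ a₂ b₂ a₃ b₃} →
    exchange x y ≡ (a₁ , b₁) → exchange b₁ z ≡ (a₂ , b₂) → exchange a₁ a₂ ≡ (a₃ , b₃) →
    exchange₁₂ (exchange₂₃ (exchange₁₂ (x , y , z))) ≡ (a₃ , b₃ , b₂)
  exchange-121 e₁ e₂ e₃ rewrite e₁ | e₂ | e₃ = refl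

exchange-braid : ∀ t → exchange₂₃ (exchange₁₂ (exchange₂₃ t)) ≡ exchange₁₂ (exchange₂₃ (exchange₁₂ t))
exchange-braid (x , y , z) with ≤-<-connex x y | ≤-<-connex y z
... | inj₁ x≤y | inj₁ y≤z =
  trans (exchange-232 (exchange-≤ y≤z) (exchange-≤ (≤-trans x≤y (m≤n⇒m≤1+n y≤z))) (exchange-≤ x≤y))
        (sym (exchange-121 (exchange-≤ x≤y) (exchange-≤ (≤-trans x≤y y≤z)) (exchange-≤ (s≤s y≤z))))
exchange-braid (x , suc y , z) | inj₁ x≤y | inj₂ z<y with ≤-<-connex x z
... | inj₁ x≤z =
  trans (exchange-232 (exchange-> z<y) (exchange-≤ x≤z) (exchange-≤ {x} {y} (≤-trans x≤z (≤-pred z<y))))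
        (sym (exchange-121 (exchange-≤ x≤y) (exchange-≤ x≤z) (exchange-> {suc (suc y)} {suc z} (s≤s z<y))))
exchange-braid (suc x , suc y , z) | inj₁ x≤y | inj₂ z<y | inj₂ z<x =
  trans (exchange-232 (exchange-> z<y) (exchange-> z<x) (exchange-≤ (≤-pred x≤y)))
        (sym (exchange-121 (exchange-≤ x≤y) (exchange-> z<x)
                           (exchange-> {suc (suc y)} {z} (m≤n⇒m≤1+n (≤-trans z<x x≤y)))))
exchange-braid (suc x , y , z) | inj₂ y<x | inj₁ y≤z with ≤-<-connex (suc x) (suc z)
... | inj₁ x≤z =
  trans (exchange-232 (exchange-≤ y≤z) (exchange-≤ x≤z) (exchange-> y<x))
        (sym (exchange-121 (exchange-> y<x) (exchange-≤ {x} {z} (≤-pred x≤z))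
                           (exchange-≤ {y} {suc z} (m≤n⇒m≤1+n y≤z))))
exchange-braid (suc zero , y , z) | inj₂ _ | inj₁ _ | inj₂ (s≤s ())
exchange-braid (suc (suc x) , y , z) | inj₂ y<x | inj₁ y≤z | inj₂ z<x =
  trans (exchange-232 (exchange-≤ y≤z) (exchange-> z<x)
                      (exchange-> {suc x} {y} (<-≤-trans (s≤s y≤z) (≤-pred z<x))))
        (sym (exchange-121 (exchange-> y<x) (exchange-> {suc x} {z} (≤-pred z<x)) (exchange-≤ y≤z)))
exchange-braid (suc zero , suc y , z) | inj₂ (s≤s ()) | inj₂ _
exchange-braid (suc (suc x) , suc y , z) | inj₂ y<x | inj₂ z<y =
  trans (exchange-232 (exchange-> z<y) (exchange-> {suc (suc x)} {z} (<-trans z<y y<x))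
                      (exchange-> {suc x} {y} (≤-pred y<x)))
        (sym (exchange-121 (exchange-> y<x) (exchange-> {suc x} {z} (<-≤-trans z<y (≤-pred y<x)))
                           (exchange-> z<y)))

-- The cyclic successor on Fin N

[m+n%d]%d≡[m+n]%d : ∀ m n d .{{_ : NonZero d}} → (m + n % d) % d ≡ (m + n) % d
[m+n%d]%d≡[m+n]%d m n d = begin
  (m + n % d) % d             ≡⟨ %-distribˡ-+ m (n % d) d ⟩
  (m % d + n % d % d) % d     ≡⟨ cong (λ x → (m % d + x) % d) (m%n%n≡m%n n d) ⟩
  (m % d + n % d) % d         ≡⟨ %-distribˡ-+ m n d ⟨
  (m + n) % d                 ∎
  where open ≡-Reasoning

module _ {N : ℕ} .{{_ : NonZero N}} where
  open ≡-Reasoning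

  opaque
    next : Fin N → Fin N
    next i = suc (toℕ i) mod N

    toℕ-next : ∀ i → toℕ (next i) ≡ suc (toℕ i) % N
    toℕ-next i = toℕ-fromℕ< _

  next-view : ∀ i → (suc (toℕ i) < N × toℕ (next i) ≡ suc (toℕ i)) ⊎ (suc (toℕ i) ≡ N × toℕ (next i) ≡ 0)
  next-view i with m≤n⇒m<n∨m≡n (toℕ<n i)
  ... | inj₁ i+1<N = inj₁ (i+1<N , trans (toℕ-next i) (m<n⇒m%n≡m i+1<N))
  ... | inj₂ i+1≡N = inj₂ (i+1≡N , trans (toℕ-next i) (trans (cong (_% N) i+1≡N) (n%n≡0 N)))

  Adj⇒≡next : ∀ {i j} → Adj i j → j ≡ next i
  Adj⇒≡next {i} (inj₁ j≡i+1) =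
    toℕ-injective (trans j≡i+1 (sym (trans (toℕ-next i) (m<n⇒m%n≡m (subst (_< N) j≡i+1 (toℕ<n _))))))
  Adj⇒≡next {i} (inj₂ (i+1≡N , j≡0)) =
    toℕ-injective (trans j≡0 (sym (trans (toℕ-next i) (trans (cong (_% N) i+1≡N) (n%n≡0 N)))))

  ≡next⇒Adj : ∀ {i j} → j ≡ next i → Adj i j
  ≡next⇒Adj {i} refl with next-view i
  ... | inj₁ (_ , eq) = inj₁ eq
  ... | inj₂ eqs      = inj₂ eqs

  next^ : ℕ → Fin N → Fin N
  next^ zero    i = i
  next^ (suc t) i = next (next^ t i)

  toℕ-next^ : ∀ t i → toℕ (next^ t i) ≡ (t + toℕ i) % N
  toℕ-next^ zero    i = sym (m<n⇒m%n≡m (toℕ<n i))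
  toℕ-next^ (suc t) i = begin
    toℕ (next (next^ t i))    ≡⟨ toℕ-next (next^ t i) ⟩
    suc (toℕ (next^ t i)) % N ≡⟨ cong (λ x → suc x % N) (toℕ-next^ t i) ⟩
    (1 + (t + toℕ i) % N) % N ≡⟨ [m+n%d]%d≡[m+n]%d 1 (t + toℕ i) N ⟩
    suc (t + toℕ i) % N       ∎

  next^-N : ∀ i → next^ N i ≡ i
  next^-N i = toℕ-injective (begin
    toℕ (next^ N i)   ≡⟨ toℕ-next^ N i ⟩
    (N + toℕ i) % N   ≡⟨ cong (_% N) (+-comm N (toℕ i)) ⟩
    (toℕ i + N) % N   ≡⟨ [m+n]%n≡m%n (toℕ i) N ⟩
    toℕ i % N         ≡⟨ m<n⇒m%n≡m (toℕ<n i) ⟩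
    toℕ i             ∎)

  next^-reaches : ∀ i j → next^ (N ∸ toℕ i + toℕ j) i ≡ j
  next^-reaches i j = toℕ-injective (begin
    toℕ (next^ (N ∸ toℕ i + toℕ j) i)  ≡⟨ toℕ-next^ _ i ⟩
    (N ∸ toℕ i + toℕ j + toℕ i) % N     ≡⟨ cong (_% N) (swap (N ∸ toℕ i) (toℕ j) (toℕ i)) ⟩
    (N ∸ toℕ i + toℕ i + toℕ j) % N     ≡⟨ cong (λ x → (x + toℕ j) % N) (m∸n+n≡m (<⇒≤ (toℕ<n i))) ⟩
    (N + toℕ j) % N                     ≡⟨ toℕ-next^ N j ⟨
    toℕ (next^ N j)                     ≡⟨ cong toℕ (next^-N j) ⟩
    toℕ j                               ∎)
    where
    swap : ∀ x y z → x + y + z ≡ x + z + y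
    swap = solve-∀

  prev : Fin N → Fin N
  prev = next^ (pred N)

  next-prev : ∀ i → next (prev i) ≡ i
  next-prev i = trans (cong (λ t → next^ t i) (suc-pred N)) (next^-N i)

  prev-next : ∀ i → prev (next i) ≡ i
  prev-next i = toℕ-injective (begin
    toℕ (next^ (pred N) (next i))   ≡⟨ toℕ-next^ (pred N) (next i) ⟩
    (pred N + toℕ (next i)) % N     ≡⟨ cong (λ x → (pred N + x) % N) (toℕ-next i) ⟩
    (pred N + suc (toℕ i) % N) % N  ≡⟨ [m+n%d]%d≡[m+n]%d (pred N) (suc (toℕ i)) N ⟩
    (pred N + suc (toℕ i)) % N      ≡⟨ cong (_% N) (+-suc (pred N) (toℕ i)) ⟩
    (suc (pred N) + toℕ i) % N      ≡⟨ cong (λ x → (x + toℕ i) % N) (suc-pred N) ⟩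
    (N + toℕ i) % N                 ≡⟨ toℕ-next^ N i ⟨
    toℕ (next^ N i)                 ≡⟨ cong toℕ (next^-N i) ⟩
    toℕ i                           ∎)

  next-injective : ∀ {i j} → next i ≡ next j → i ≡ j
  next-injective {i} {j} eq = trans (sym (prev-next i)) (trans (cong prev eq) (prev-next j))

  next≢id : 2 ≤ N → ∀ i → next i ≢ i
  next≢id 2≤N i eq with next-view i
  ... | inj₁ (_ , t)     = 1+n≢n (sym (trans (cong toℕ (sym eq)) t))
  ... | inj₂ (i+1≡N , t) = <⇒≱ 2≤N (≤-reflexive (trans (sym i+1≡N) (cong suc (trans (cong toℕ (sym eq)) t))))

  N≡2⇒next²≡id : N ≡ 2 → ∀ i → next (next i) ≡ i
  N≡2⇒next²≡id refl i = toℕ-injective (begin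
    toℕ (next^ 2 i)    ≡⟨ toℕ-next^ 2 i ⟩
    (2 + toℕ i) % 2    ≡⟨ cong (_% 2) (+-comm 2 (toℕ i)) ⟩
    (toℕ i + 2) % 2    ≡⟨ [m+n]%n≡m%n (toℕ i) 2 ⟩
    toℕ i % 2          ≡⟨ m<n⇒m%n≡m (toℕ<n i) ⟩
    toℕ i              ∎)

  -- next (next i) ≡ i forces N ∣ 2.
  next²≢id : 3 ≤ N → ∀ i → next (next i) ≢ i
  next²≢id 3≤N i eq = <⇒≱ 3≤N (∣⇒≤ (divides q (+-cancelʳ-≡ (toℕ i) 2 (q * N) 2+i≡qN+i)))
    where
    q = (2 + toℕ i) / N
    2+i≡qN+i : 2 + toℕ i ≡ q * N + toℕ i
    2+i≡qN+i = begin
      2 + toℕ i                  ≡⟨ m≡m%n+[m/n]*n (2 + toℕ i) N ⟩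
      (2 + toℕ i) % N + q * N    ≡⟨ cong (_+ q * N) (trans (sym (toℕ-next^ 2 i)) (cong toℕ eq)) ⟩
      toℕ i + q * N              ≡⟨ +-comm (toℕ i) (q * N) ⟩
      q * N + toℕ i              ∎

[]≔²-commutes : ∀ {A : Set} {n} (xs : Vec A n) {i j k l : Fin n} {a b c d : A} →
  i ≢ k → i ≢ l → j ≢ k → j ≢ l →
  (((xs [ i ]≔ a) [ j ]≔ b) [ k ]≔ c) [ l ]≔ d ≡ (((xs [ k ]≔ c) [ l ]≔ d) [ i ]≔ a) [ j ]≔ b
[]≔²-commutes xs {i} {j} {k} {l} {a} {b} {c} {d} i≢k i≢l j≢k j≢l = begin
  (((xs [ i ]≔ a) [ j ]≔ b) [ k ]≔ c) [ l ]≔ d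
    ≡⟨ cong (_[ l ]≔ d) ([]≔-commutes _ j k j≢k) ⟩
  (((xs [ i ]≔ a) [ k ]≔ c) [ j ]≔ b) [ l ]≔ d
    ≡⟨ []≔-commutes _ j l j≢l ⟩
  (((xs [ i ]≔ a) [ k ]≔ c) [ l ]≔ d) [ j ]≔ b
    ≡⟨ cong (λ ys → (ys [ l ]≔ d) [ j ]≔ b) ([]≔-commutes xs i k i≢k) ⟩
  (((xs [ k ]≔ c) [ i ]≔ a) [ l ]≔ d) [ j ]≔ b
    ≡⟨ cong (_[ j ]≔ b) ([]≔-commutes _ i l i≢l) ⟩
  (((xs [ k ]≔ c) [ l ]≔ d) [ i ]≔ a) [ j ]≔ b
    ∎
  where open ≡-Reasoning

sum-[]≔ : ∀ {n} (xs : Vec ℕ n) k x → V.sum (xs [ k ]≔ x) + lookup xs k ≡ V.sum xs + x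
sum-[]≔ (y V.∷ xs) Fin.zero    x = swap x (V.sum xs) y
  where
  swap : ∀ x s y → x + s + y ≡ y + s + x
  swap = solve-∀
sum-[]≔ (y V.∷ xs) (Fin.suc k) x = begin
  y + V.sum (xs [ k ]≔ x) + lookup xs k    ≡⟨ +-assoc y _ _ ⟩
  y + (V.sum (xs [ k ]≔ x) + lookup xs k)  ≡⟨ cong (y +_) (sum-[]≔ xs k x) ⟩
  y + (V.sum xs + x)                       ≡⟨ +-assoc y _ _ ⟨
  y + V.sum xs + x                         ∎
  where open ≡-Reasoning

sum-replicate-0 : ∀ n → V.sum (V.replicate n 0) ≡ 0
sum-replicate-0 zero    = refl
sum-replicate-0 (suc n) = sum-replicate-0 n

HasZero : ∀ {n} → Vec ℕ n → Set
HasZero a = ∃ λ k → lookup a k ≡ 0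

module _ {N : ℕ} where

  ≡⇒~ : {u v : List (Fin N)} → u ≡ v → u ~ v
  ≡⇒~ refl = ~refl

  ~-setoid : Setoid _ _
  ~-setoid = record
    { Carrier       = List (Fin N)
    ; _≈_           = _~_
    ; isEquivalence = record { refl = ~refl ; sym = ~sym ; trans = ~trans }
    }

  ~-++ˡ : ∀ u {v w : List (Fin N)} → v ~ w → (u ++ v) ~ (u ++ w)
  ~-++ˡ u ~refl            = ~refl
  ~-++ˡ u (~sym v~w)       = ~sym (~-++ˡ u v~w)
  ~-++ˡ u (~trans v~w w~x) = ~trans (~-++ˡ u v~w) (~-++ˡ u w~x)
  ~-++ˡ u (~rel {r} rel v w) =
    ~trans (≡⇒~ (sym (++-assoc u v (r ++ w))))
           (~trans (~rel rel (u ++ v) w) (≡⇒~ (++-assoc u v w)))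

  ~-++ʳ : ∀ {v w : List (Fin N)} → v ~ w → ∀ u → (v ++ u) ~ (w ++ u)
  ~-++ʳ ~refl            u = ~refl
  ~-++ʳ (~sym v~w)       u = ~sym (~-++ʳ v~w u)
  ~-++ʳ (~trans v~w w~x) u = ~trans (~-++ʳ v~w u) (~-++ʳ w~x u)
  ~-++ʳ (~rel {r} rel v w) u =
    ~trans (≡⇒~ (trans (++-assoc v (r ++ w) u) (cong (v ++_) (++-assoc r w u))))
           (~trans (~rel rel v (w ++ u)) (≡⇒~ (sym (++-assoc v w u))))

IsLength-unique : ∀ {N x k k′} → IsLength N x k → IsLength N x k′ → k ≡ k′
IsLength-unique ((w , w~x , |w|≡k) , k≤) ((w′ , w′~x , |w′|≡k′) , k′≤) =
  ≤-antisym (subst (_ ≤_) |w′|≡k′ (k≤ w′ w′~x)) (subst (_ ≤_) |w|≡k (k′≤ w w~x))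

-- Codes and the action of Ã_{N-1}

module Codes {N : ℕ} (2≤N : 2 ≤ N) where

  instance
    N-nonZero : NonZero N
    N-nonZero = >-nonZero (≤-trans (s≤s z≤n) 2≤N)

  Code : Set
  Code = Vec ℕ N

  size : Code → ℕ
  size = V.sum

  exchangeAt : Code → Fin N → ℕ × ℕ
  exchangeAt a i = exchange (lookup a i) (lookup a (next i))

  opaque
    act : Fin N → Code → Code
    act i a = (a [ i ]≔ proj₁ (exchangeAt a i)) [ next i ]≔ proj₂ (exchangeAt a i)

  Distant : Fin N → Fin N → Set
  Distant i j = i ≢ j × i ≢ next j × next i ≢ j

  Distant-sym : ∀ {i j} → Distant i j → Distant j i
  Distant-sym (i≢j , i≢j+1 , i+1≢j) = i≢j ∘ sym , i+1≢j ∘ sym , i≢j+1 ∘ sym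

  opaque
    unfolding act

    act-≡ : ∀ i a → act i a ≡ (a [ i ]≔ proj₁ (exchangeAt a i)) [ next i ]≔ proj₂ (exchangeAt a i)
    act-≡ i a = refl

  module _ (i : Fin N) (a : Code) where
    private
      x = proj₁ (exchangeAt a i)
      y = proj₂ (exchangeAt a i)

    lookup-act-at : lookup (act i a) i ≡ x
    lookup-act-at = begin
      lookup (act i a) i                          ≡⟨ cong (λ b → lookup b i) (act-≡ i a) ⟩
      lookup ((a [ i ]≔ x) [ next i ]≔ y) i       ≡⟨ lookup∘update′ (next≢id 2≤N i ∘ sym) (a [ i ]≔ x) y ⟩
      lookup (a [ i ]≔ x) i                       ≡⟨ lookup∘update i a x ⟩
      x                                           ∎
      where open ≡-Reasoning

    lookup-act-next : lookup (act i a) (next i) ≡ y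
    lookup-act-next = trans (cong (λ b → lookup b (next i)) (act-≡ i a)) (lookup∘update (next i) (a [ i ]≔ x) y)

    lookup-act-other : ∀ {k} → k ≢ i → k ≢ next i → lookup (act i a) k ≡ lookup a k
    lookup-act-other {k} k≢i k≢i+1 = begin
      lookup (act i a) k                          ≡⟨ cong (λ b → lookup b k) (act-≡ i a) ⟩
      lookup ((a [ i ]≔ x) [ next i ]≔ y) k       ≡⟨ lookup∘update′ k≢i+1 (a [ i ]≔ x) y ⟩
      lookup (a [ i ]≔ x) k                       ≡⟨ lookup∘update′ k≢i a x ⟩
      lookup a k                                  ∎
      where open ≡-Reasoning

  act-updates : ∀ {i a x y} → exchangeAt a i ≡ (x , y) → act i a ≡ (a [ i ]≔ x) [ next i ]≔ y
  act-updates {i} {a} eq = trans (act-≡ i a) (cong (λ (x , y) → (a [ i ]≔ x) [ next i ]≔ y) eq)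

  act-involutive : ∀ i a → act i (act i a) ≡ a
  act-involutive i a = begin
    act i (act i a)
      ≡⟨ act-updates exchange-back ⟩
    (act i a [ i ]≔ aᵢ) [ next i ]≔ aᵢ₊₁
      ≡⟨ cong (λ b → (b [ i ]≔ aᵢ) [ next i ]≔ aᵢ₊₁) (act-≡ i a) ⟩
    (((a [ i ]≔ x) [ next i ]≔ y) [ i ]≔ aᵢ) [ next i ]≔ aᵢ₊₁
      ≡⟨ cong (_[ next i ]≔ aᵢ₊₁) ([]≔-commutes (a [ i ]≔ x) (next i) i (next≢id 2≤N i)) ⟩
    (((a [ i ]≔ x) [ i ]≔ aᵢ) [ next i ]≔ y) [ next i ]≔ aᵢ₊₁
      ≡⟨ []≔-idempotent ((a [ i ]≔ x) [ i ]≔ aᵢ) (next i) ⟩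
    ((a [ i ]≔ x) [ i ]≔ aᵢ) [ next i ]≔ aᵢ₊₁
      ≡⟨ cong (_[ next i ]≔ aᵢ₊₁) (trans ([]≔-idempotent a i) ([]≔-lookup a i)) ⟩
    a [ next i ]≔ aᵢ₊₁
      ≡⟨ []≔-lookup a (next i) ⟩
    a ∎
    where
    open ≡-Reasoning
    x = proj₁ (exchangeAt a i)
    y = proj₂ (exchangeAt a i)
    aᵢ = lookup a i
    aᵢ₊₁ = lookup a (next i)
    exchange-back : exchangeAt (act i a) i ≡ (aᵢ , aᵢ₊₁)
    exchange-back = trans (cong₂ exchange (lookup-act-at i a) (lookup-act-next i a)) (exchange-involutive aᵢ aᵢ₊₁)

  exchangeAt-act-distant : ∀ {i j} a → Distant i j → exchangeAt (act j a) i ≡ exchangeAt a i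
  exchangeAt-act-distant {i} {j} a (i≢j , i≢j+1 , i+1≢j) =
    cong₂ exchange (lookup-act-other j a i≢j i≢j+1) (lookup-act-other j a i+1≢j (i≢j ∘ next-injective))

  act-comm : ∀ {i j} a → Distant i j → act i (act j a) ≡ act j (act i a)
  act-comm {i} {j} a d@(i≢j , i≢j+1 , i+1≢j) = begin
    act i (act j a)
      ≡⟨ act-updates (exchangeAt-act-distant a d) ⟩
    (act j a [ i ]≔ x) [ next i ]≔ y
      ≡⟨ cong (λ b → (b [ i ]≔ x) [ next i ]≔ y) (act-≡ j a) ⟩
    (((a [ j ]≔ x′) [ next j ]≔ y′) [ i ]≔ x) [ next i ]≔ y
      ≡⟨ []≔²-commutes a (i≢j ∘ sym) (i+1≢j ∘ sym) (i≢j+1 ∘ sym) ((i≢j ∘ next-injective) ∘ sym) ⟩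
    (((a [ i ]≔ x) [ next i ]≔ y) [ j ]≔ x′) [ next j ]≔ y′
      ≡⟨ cong (λ b → (b [ j ]≔ x′) [ next j ]≔ y′) (act-≡ i a) ⟨
    (act i a [ j ]≔ x′) [ next j ]≔ y′
      ≡⟨ act-updates (exchangeAt-act-distant a (Distant-sym d)) ⟨
    act j (act i a) ∎
    where
    open ≡-Reasoning
    x = proj₁ (exchangeAt a i)
    y = proj₂ (exchangeAt a i)
    x′ = proj₁ (exchangeAt a j)
    y′ = proj₂ (exchangeAt a j)

  size-act : ∀ i a → size (act i a) + lookup a i + lookup a (next i) ≡
                    size a + proj₁ (exchangeAt a i) + proj₂ (exchangeAt a i)
  size-act i a = begin
    size (act i a) + aᵢ + aᵢ₊₁                        ≡⟨ swap (size (act i a)) aᵢ aᵢ₊₁ ⟩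
    size (act i a) + aᵢ₊₁ + aᵢ                        ≡⟨ cong (λ c → size c + aᵢ₊₁ + aᵢ) (act-≡ i a) ⟩
    size (b [ next i ]≔ y) + aᵢ₊₁ + aᵢ                ≡⟨ cong (λ z → size (b [ next i ]≔ y) + z + aᵢ) bᵢ₊₁≡aᵢ₊₁ ⟨
    size (b [ next i ]≔ y) + lookup b (next i) + aᵢ   ≡⟨ cong (_+ aᵢ) (sum-[]≔ b (next i) y) ⟩
    size b + y + aᵢ                                   ≡⟨ swap (size b) y aᵢ ⟩
    size b + aᵢ + y                                   ≡⟨ cong (_+ y) (sum-[]≔ a i x) ⟩
    size a + x + y                                    ∎
    where
    open ≡-Reasoning
    aᵢ = lookup a i
    aᵢ₊₁ = lookup a (next i)
    x = proj₁ (exchangeAt a i)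
    y = proj₂ (exchangeAt a i)
    b = a [ i ]≔ x
    bᵢ₊₁≡aᵢ₊₁ : lookup b (next i) ≡ aᵢ₊₁
    bᵢ₊₁≡aᵢ₊₁ = lookup∘update′ (next≢id 2≤N i) a x
    swap : ∀ s u v → s + u + v ≡ s + v + u
    swap = solve-∀

  run : List (Fin N) → Code → Code
  run []      a = a
  run (i ∷ w) a = run w (act i a)

  run-++ : ∀ u v a → run (u ++ v) a ≡ run v (run u a)
  run-++ []      v a = refl
  run-++ (i ∷ u) v a = run-++ u v (act i a)

  Clear : Fin N → Fin N → Set
  Clear k p = k ≢ p × k ≢ next p

  lookup-run-clear : ∀ {k} ps a → All (Clear k) ps → lookup (run ps a) k ≡ lookup a k
  lookup-run-clear []       a []                   = refl
  lookup-run-clear (p ∷ ps) a ((k≢p , k≢p+1) ∷ clear) =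
    trans (lookup-run-clear ps (act p a) clear) (lookup-act-other p a k≢p k≢p+1)

  lookup-run-distant : ∀ {ps} → AllPairs Distant ps → ∀ {p} → p ∈ ps → ∀ a →
                       (lookup (run ps a) p , lookup (run ps a) (next p)) ≡ exchangeAt a p
  lookup-run-distant {p ∷ ps} (distant ∷ _) (here refl) a =
    cong₂ _,_ (trans (lookup-run-clear ps (act p a) (All.map clear-p distant)) (lookup-act-at p a))
              (trans (lookup-run-clear ps (act p a) (All.map clear-p+1 distant)) (lookup-act-next p a))
    where
    clear-p : ∀ {q} → Distant p q → Clear p q
    clear-p (p≢q , p≢q+1 , _) = p≢q , p≢q+1
    clear-p+1 : ∀ {q} → Distant p q → Clear (next p) q
    clear-p+1 (p≢q , _ , p+1≢q) = p+1≢q , p≢q ∘ next-injective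
  lookup-run-distant {q ∷ ps} (distant ∷ distants) (there p∈ps) a =
    trans (lookup-run-distant distants p∈ps (act q a)) (exchangeAt-act-distant a (Distant-sym (All.lookup distant p∈ps)))

  act-braid : 3 ≤ N → ∀ p a → act (next p) (act p (act (next p) a)) ≡ act p (act (next p) (act p a))
  act-braid 3≤N p a = Pointwise-≡⇒≡ (ext pointwise)
    where
    open ≡-Reasoning
    q r : Fin N
    q = next p
    r = next q
    p≢q : p ≢ q
    p≢q = next≢id 2≤N p ∘ sym
    q≢r : q ≢ r
    q≢r = next≢id 2≤N q ∘ sym
    r≢p : r ≢ p
    r≢p = next²≢id 3≤N p

    triple : Code → Triple
    triple b = lookup b p , lookup b q , lookup b r

    triple-act-p : ∀ b → triple (act p b) ≡ exchange₁₂ (triple b)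
    triple-act-p b =
      cong₂ _,_ (lookup-act-at p b) (cong₂ _,_ (lookup-act-next p b) (lookup-act-other p b r≢p (q≢r ∘ sym)))

    triple-act-q : ∀ b → triple (act q b) ≡ exchange₂₃ (triple b)
    triple-act-q b =
      cong₂ _,_ (lookup-act-other q b p≢q (r≢p ∘ sym)) (cong₂ _,_ (lookup-act-at q b) (lookup-act-next q b))

    triples : triple (act q (act p (act q a))) ≡ triple (act p (act q (act p a)))
    triples = begin
      triple (act q (act p (act q a)))                 ≡⟨ triple-act-q (act p (act q a)) ⟩
      exchange₂₃ (triple (act p (act q a)))            ≡⟨ cong exchange₂₃ (triple-act-p (act q a)) ⟩
      exchange₂₃ (exchange₁₂ (triple (act q a)))       ≡⟨ cong (exchange₂₃ ∘ exchange₁₂) (triple-act-q a) ⟩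
      exchange₂₃ (exchange₁₂ (exchange₂₃ (triple a)))  ≡⟨ exchange-braid (triple a) ⟩
      exchange₁₂ (exchange₂₃ (exchange₁₂ (triple a)))  ≡⟨ cong (exchange₁₂ ∘ exchange₂₃) (triple-act-p a) ⟨
      exchange₁₂ (exchange₂₃ (triple (act p a)))       ≡⟨ cong exchange₁₂ (triple-act-q (act p a)) ⟨
      exchange₁₂ (triple (act q (act p a)))            ≡⟨ triple-act-p (act q (act p a)) ⟨
      triple (act p (act q (act p a)))                 ∎

    pointwise : ∀ k → lookup (act q (act p (act q a))) k ≡ lookup (act p (act q (act p a))) k
    pointwise k = by-cases (k ≟ p) (k ≟ q) (k ≟ r)
      where
      by-cases : Dec (k ≡ p) → Dec (k ≡ q) → Dec (k ≡ r) →
                 lookup (act q (act p (act q a))) k ≡ lookup (act p (act q (act p a))) k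
      by-cases (yes refl) _          _          = cong proj₁ triples
      by-cases (no _)     (yes refl) _          = cong (proj₁ ∘ proj₂) triples
      by-cases (no _)     (no _)     (yes refl) = cong (proj₂ ∘ proj₂) triples
      by-cases (no k≢p)   (no k≢q)   (no k≢r)   =
        trans (lookup-run-clear (q ∷ p ∷ q ∷ []) a (clear-q ∷ clear-p ∷ clear-q ∷ []))
              (sym (lookup-run-clear (p ∷ q ∷ p ∷ []) a (clear-p ∷ clear-q ∷ clear-p ∷ [])))
        where
        clear-p : Clear k p
        clear-p = k≢p , k≢q
        clear-q : Clear k q
        clear-q = k≢q , k≢r

  run-relator : ∀ {r} → Relator N r → ∀ a → run r a ≡ a
  run-relator (sq i) a = act-involutive i a
  run-relator (braid 3≤N i j adj) a with Adj⇒≡next adj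
  ... | refl = begin
    act j (act i (act j (act i (act j (act i a)))))  ≡⟨ act-braid 3≤N i _ ⟩
    act i (act j (act i (act i (act j (act i a)))))  ≡⟨ cong (act i ∘ act j) (act-involutive i _) ⟩
    act i (act j (act j (act i a)))                  ≡⟨ cong (act i) (act-involutive j _) ⟩
    act i (act i a)                                  ≡⟨ act-involutive i a ⟩
    a                                                ∎
    where open ≡-Reasoning
  run-relator (comm i j i≢j ¬adj ¬adj′) a = begin
    act j (act i (act j (act i a)))  ≡⟨ act-comm _ distant ⟩
    act i (act j (act j (act i a)))  ≡⟨ cong (act i) (act-involutive j _) ⟩
    act i (act i a)                  ≡⟨ act-involutive i a ⟩
    a                                ∎
    where
    open ≡-Reasoning
    distant : Distant j i
    distant = i≢j ∘ sym , ¬adj ∘ ≡next⇒Adj , ¬adj′ ∘ ≡next⇒Adj ∘ sym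

  run-resp : ∀ {u v} → u ~ v → ∀ a → run u a ≡ run v a
  run-resp ~refl          a = refl
  run-resp (~sym u~v)     a = sym (run-resp u~v a)
  run-resp (~trans u~v v~w) a = trans (run-resp u~v a) (run-resp v~w a)
  run-resp (~rel {r} rel u v) a = begin
    run (u ++ (r ++ v)) a     ≡⟨ run-++ u (r ++ v) a ⟩
    run (r ++ v) (run u a)    ≡⟨ run-++ r v (run u a) ⟩
    run v (run r (run u a))   ≡⟨ cong (run v) (run-relator rel (run u a)) ⟩
    run v (run u a)           ≡⟨ run-++ u v a ⟨
    run (u ++ v) a            ∎
    where open ≡-Reasoning

  zeros : Code
  zeros = V.replicate N 0

  code : List (Fin N) → Code
  code w = run w zeros

  code-resp : ∀ {u v} → u ~ v → code u ≡ code v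
  code-resp u~v = run-resp u~v zeros

  record Descent (a : Code) (i : Fin N) : Set where
    constructor descent
    field descends : lookup a (next i) < lookup a i

  open Descent

  descent? : ∀ a i → Dec (Descent a i)
  descent? a i = map′ descent descends (lookup a (next i) <? lookup a i)

  module _ {i : Fin N} {a : Code} where

    exchangeAt-descent : Descent a i → exchangeAt a i ≡ (lookup a (next i) , pred (lookup a i))
    exchangeAt-descent = exchange-> ∘ descends

    exchangeAt-ascent : ¬ Descent a i → exchangeAt a i ≡ (suc (lookup a (next i)) , lookup a i)
    exchangeAt-ascent ¬d = exchange-≤ (≮⇒≥ (¬d ∘ descent))

    lookup-act-at-descent : Descent a i → lookup (act i a) i ≡ lookup a (next i)
    lookup-act-at-descent d = trans (lookup-act-at i a) (cong proj₁ (exchangeAt-descent d))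

    lookup-act-next-descent : Descent a i → lookup (act i a) (next i) ≡ pred (lookup a i)
    lookup-act-next-descent d = trans (lookup-act-next i a) (cong proj₂ (exchangeAt-descent d))

    lookup-act-at-ascent : ¬ Descent a i → lookup (act i a) i ≡ suc (lookup a (next i))
    lookup-act-at-ascent ¬d = trans (lookup-act-at i a) (cong proj₁ (exchangeAt-ascent ¬d))

    lookup-act-next-ascent : ¬ Descent a i → lookup (act i a) (next i) ≡ lookup a i
    lookup-act-next-ascent ¬d = trans (lookup-act-next i a) (cong proj₂ (exchangeAt-ascent ¬d))

    descent-act-ascent : ¬ Descent a i → Descent (act i a) i
    descent-act-ascent ¬d =
      descent (subst₂ _<_ (sym (lookup-act-next-ascent ¬d)) (sym (lookup-act-at-ascent ¬d)) (s≤s (≮⇒≥ (¬d ∘ descent))))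

    size-act-descent : Descent a i → suc (size (act i a)) ≡ size a
    size-act-descent d =
      cancel (size (act i a)) (size a) (lookup a i) (lookup a (next i)) (descends d)
             (trans (size-act i a) (cong (λ (x , y) → size a + x + y) (exchangeAt-descent d)))
      where
      rearrangeˡ : ∀ s x y → suc s + (x + y) ≡ s + suc x + y
      rearrangeˡ = solve-∀
      rearrangeʳ : ∀ t x y → t + y + x ≡ t + (x + y)
      rearrangeʳ = solve-∀
      cancel : ∀ s t x y → y < x → s + x + y ≡ t + y + pred x → suc s ≡ t
      cancel s t (suc x) y _ eq = +-cancelʳ-≡ (x + y) _ _ (trans (rearrangeˡ s x y) (trans eq (rearrangeʳ t x y)))

    size-act-< : Descent a i → size (act i a) < size a
    size-act-< d = ≤-reflexive (size-act-descent d)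

    size-act-ascent : ¬ Descent a i → size (act i a) ≡ suc (size a)
    size-act-ascent ¬d =
      cancel (size (act i a)) (size a) (lookup a i) (lookup a (next i))
             (trans (size-act i a) (cong (λ (x , y) → size a + x + y) (exchangeAt-ascent ¬d)))
      where
      rearrange : ∀ t x y → t + suc y + x ≡ suc t + (x + y)
      rearrange = solve-∀
      cancel : ∀ s t x y → s + x + y ≡ t + suc y + x → s ≡ suc t
      cancel s t x y eq = +-cancelʳ-≡ (x + y) _ _ (trans (sym (+-assoc s x y)) (trans eq (rearrange t x y)))

  act-HasZero : ∀ i {a} → HasZero a → HasZero (act i a)
  act-HasZero i {a} (k , aₖ≡0) with descent? a i | k ≟ i | k ≟ next i
  ... | yes d | yes refl | _        = contradiction (subst (lookup a (next i) <_) aₖ≡0 (descends d)) n≮0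
  ... | yes d | no _     | yes refl = i , trans (lookup-act-at-descent d) aₖ≡0
  ... | no ¬d | yes refl | _        = next i , trans (lookup-act-next-ascent ¬d) aₖ≡0
  ... | no ¬d | no _     | yes refl =
    next i , trans (lookup-act-next-ascent ¬d) (n≤0⇒n≡0 (subst (lookup a i ≤_) aₖ≡0 (≮⇒≥ (¬d ∘ descent))))
  ... | _     | no k≢i   | no k≢i+1 = k , trans (lookup-act-other i a k≢i k≢i+1) aₖ≡0

  run-HasZero : ∀ w {a} → HasZero a → HasZero (run w a)
  run-HasZero []      z = z
  run-HasZero (i ∷ w) z = run-HasZero w (act-HasZero i z)

  code-HasZero : ∀ w → HasZero (code w)
  code-HasZero w = run-HasZero w (0 mod N , lookup-replicate (0 mod N) 0)

  cancel-move : ∀ (i : Fin N) → (i ∷ i ∷ []) ~ []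
  cancel-move i = ~rel (sq i) [] []

  comm-move : ∀ {i j} → Distant i j → (j ∷ i ∷ []) ~ (i ∷ j ∷ [])
  comm-move {i} {j} (i≢j , i≢j+1 , i+1≢j) =
    ~trans (~sym (~rel (comm i j i≢j (i+1≢j ∘ sym ∘ Adj⇒≡next) (i≢j+1 ∘ Adj⇒≡next)) [] (j ∷ i ∷ [])))
    (~trans (~rel (sq j) (i ∷ j ∷ i ∷ []) (i ∷ []))
            (~rel (sq i) (i ∷ j ∷ []) []))

  braid-move : 3 ≤ N → ∀ (p : Fin N) → (next p ∷ p ∷ next p ∷ []) ~ (p ∷ next p ∷ p ∷ [])
  braid-move 3≤N p =
    ~trans (~sym (~rel (braid 3≤N p q (≡next⇒Adj refl)) [] (q ∷ p ∷ q ∷ [])))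
    (~trans (~rel (sq q) (p ∷ q ∷ p ∷ q ∷ p ∷ []) (p ∷ q ∷ []))
    (~trans (~rel (sq p) (p ∷ q ∷ p ∷ q ∷ []) (q ∷ []))
            (~rel (sq q) (p ∷ q ∷ p ∷ []) [])))
    where q = next p

  -- The fuel `size a` is exact: every step along a descent lowers the size by one.
  descend : ℕ → Code → List (Fin N)
  descend zero    a = []
  descend (suc f) a with any? (descent? a)
  ... | yes (i , _) = descend f (act i a) ∷ʳ i
  ... | no _        = []

  NF : Code → List (Fin N)
  NF a = descend (size a) a

  NF-step : ∀ a → (∃ λ j → Descent a j × NF a ≡ NF (act j a) ∷ʳ j) ⊎ ((∀ j → ¬ Descent a j) × NF a ≡ [])
  NF-step a = descend-step (size a) a refl
    where
    descend-step : ∀ f a → size a ≡ f →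
      (∃ λ j → Descent a j × descend f a ≡ NF (act j a) ∷ʳ j) ⊎ ((∀ j → ¬ Descent a j) × descend f a ≡ [])
    descend-step zero a size≡0 with any? (descent? a)
    ... | yes (j , dⱼ) = contradiction (trans (size-act-descent dⱼ) size≡0) λ ()
    ... | no ¬d        = inj₂ ((λ j dⱼ → ¬d (j , dⱼ)) , refl)
    descend-step (suc f) a size≡1+f with any? (descent? a)
    ... | yes (j , dⱼ) = inj₁ (j , dⱼ , cong (λ g → descend g (act j a) ∷ʳ j) f≡size)
      where
      f≡size : f ≡ size (act j a)
      f≡size = suc-injective (trans (sym size≡1+f) (sym (size-act-descent dⱼ)))
    ... | no ¬d        = inj₂ ((λ j dⱼ → ¬d (j , dⱼ)) , refl)




  descent-act-distant : ∀ {a i j} → Distant i j → Descent a i → Descent (act j a) i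
  descent-act-distant {a} {i} {j} (i≢j , i≢j+1 , i+1≢j) (descent dᵢ) =
    descent (subst₂ _<_ (sym (lookup-act-other j a i+1≢j (i≢j ∘ next-injective)))
                        (sym (lookup-act-other j a i≢j i≢j+1)) dᵢ)

  braid-descents : ∀ {a} → 3 ≤ N → ∀ p → Descent a p → Descent a (next p) →
    Descent (act (next p) a) p × Descent (act p (act (next p) a)) (next p) ×
    Descent (act p a) (next p) × Descent (act (next p) (act p a)) p
  braid-descents {a} 3≤N p D-p D-q = descent d-b , descent d-c , descent d-d , descent d-e
    where
    q r : Fin N
    q = next p
    r = next q
    p≢q : p ≢ q
    p≢q = next≢id 2≤N p ∘ sym
    r≢p : r ≢ p
    r≢p = next²≢id 3≤N p
    r≢q : r ≢ q
    r≢q = next≢id 2≤N q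
    b = act q a
    c = act p b
    d = act p a
    e = act q d
    b-p : lookup b p ≡ lookup a p
    b-p = lookup-act-other q a p≢q (r≢p ∘ sym)
    d-r : lookup d r ≡ lookup a r
    d-r = lookup-act-other p a r≢p r≢q
    d-p = descends D-p
    d-q = descends D-q
    d-b : lookup b q < lookup b p
    d-b = subst₂ _<_ (sym (lookup-act-at-descent D-q)) (sym b-p) (<-trans d-q d-p)
    d-c : lookup c r < lookup c q
    d-c = subst₂ _<_ (sym (trans (lookup-act-other p b r≢p r≢q) (lookup-act-next-descent D-q)))
                     (sym (trans (lookup-act-next-descent (descent d-b)) (cong pred b-p)))
                     (pred-mono-< {{>-nonZero (≤-trans (s≤s z≤n) d-q)}} d-p)
    d-d : lookup d r < lookup d q
    d-d = subst₂ _<_ (sym d-r) (sym (lookup-act-next-descent D-p)) (<-≤-trans d-q (<⇒≤pred d-p))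
    d-e : lookup e q < lookup e p
    d-e = subst₂ _<_ (sym (trans (lookup-act-at-descent (descent d-d)) d-r))
                     (sym (trans (lookup-act-other q d p≢q (r≢p ∘ sym)) (lookup-act-at-descent D-p)))
                     d-q

  -- Both ways of starting NF a at two descents lead to ~-equal words: distant descents
  -- commute, and adjacent ones are resolved through the braid relation.
  module _ {a : Code} (IH : ∀ {b k} → size b < size a → Descent b k → NF b ~ (NF (act k b) ∷ʳ k)) where
    open SetoidReasoning (~-setoid {N})

    confluence-distant : ∀ {i j} → Distant i j → Descent a i → Descent a j →
                         (NF (act j a) ∷ʳ j) ~ (NF (act i a) ∷ʳ i)
    confluence-distant {i} {j} d dᵢ dⱼ = begin
      NF (act j a) ∷ʳ j
        ≈⟨ ~-++ʳ (IH (size-act-< dⱼ) (descent-act-distant d dᵢ)) [ j ] ⟩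
      NF (act i (act j a)) ∷ʳ i ∷ʳ j
        ≡⟨ ++-assoc (NF (act i (act j a))) [ i ] [ j ] ⟩
      NF (act i (act j a)) ++ (i ∷ j ∷ [])
        ≡⟨ cong (λ b → NF b ++ (i ∷ j ∷ [])) (act-comm a d) ⟩
      NF (act j (act i a)) ++ (i ∷ j ∷ [])
        ≈⟨ ~-++ˡ (NF (act j (act i a))) (comm-move d) ⟨
      NF (act j (act i a)) ++ (j ∷ i ∷ [])
        ≡⟨ ++-assoc (NF (act j (act i a))) [ j ] [ i ] ⟨
      NF (act j (act i a)) ∷ʳ j ∷ʳ i
        ≈⟨ ~-++ʳ (IH (size-act-< dᵢ) (descent-act-distant (Distant-sym d) dⱼ)) [ i ] ⟨
      NF (act i a) ∷ʳ i ∎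

    confluence-adjacent : ∀ p → Descent a p → Descent a (next p) →
                          (NF (act (next p) a) ∷ʳ next p) ~ (NF (act p a) ∷ʳ p)
    confluence-adjacent p d-p d-q with 3 ≤? N
    ... | no 3≰N = contradiction a₍ₚ₊₂₎<a₍ₚ₊₁₎ (<-asym (descends d-p))
      where
      N≡2 = ≤-antisym (≤-pred (≰⇒> 3≰N)) 2≤N
      a₍ₚ₊₂₎<a₍ₚ₊₁₎ = subst (λ r → lookup a r < lookup a (next p)) (N≡2⇒next²≡id N≡2 p) (descends d-q)
    ... | yes 3≤N = begin
      NF b ∷ʳ q
        ≈⟨ ~-++ʳ (IH (size-act-< d-q) d-b) [ q ] ⟩
      NF c ∷ʳ p ∷ʳ q
        ≈⟨ ~-++ʳ (~-++ʳ (IH (<-trans (size-act-< d-b) (size-act-< d-q)) d-c) [ p ]) [ q ] ⟩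
      NF (act q c) ∷ʳ q ∷ʳ p ∷ʳ q
        ≡⟨ reassoc (NF (act q c)) ⟩
      NF (act q c) ++ (q ∷ p ∷ q ∷ [])
        ≡⟨ cong (λ x → NF x ++ (q ∷ p ∷ q ∷ [])) (act-braid 3≤N p a) ⟩
      NF (act p e) ++ (q ∷ p ∷ q ∷ [])
        ≈⟨ ~-++ˡ (NF (act p e)) (braid-move 3≤N p) ⟩
      NF (act p e) ++ (p ∷ q ∷ p ∷ [])
        ≡⟨ reassoc (NF (act p e)) ⟨
      NF (act p e) ∷ʳ p ∷ʳ q ∷ʳ p
        ≈⟨ ~-++ʳ (~-++ʳ (IH (<-trans (size-act-< d-d) (size-act-< d-p)) d-e) [ q ]) [ p ] ⟨
      NF e ∷ʳ q ∷ʳ p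
        ≈⟨ ~-++ʳ (IH (size-act-< d-p) d-d) [ p ] ⟨
      NF d ∷ʳ p ∎
      where
      q = next p
      b = act q a
      c = act p b
      d = act p a
      e = act q d
      descents = braid-descents 3≤N p d-p d-q
      d-b = proj₁ descents
      d-c = proj₁ (proj₂ descents)
      d-d = proj₁ (proj₂ (proj₂ descents))
      d-e = proj₂ (proj₂ (proj₂ descents))
      reassoc : ∀ {x y z} (u : List (Fin N)) → u ∷ʳ x ∷ʳ y ∷ʳ z ≡ u ++ (x ∷ y ∷ z ∷ [])
      reassoc {x} {y} {z} u = trans (++-assoc (u ∷ʳ x) [ y ] [ z ]) (++-assoc u [ x ] (y ∷ z ∷ []))

  NF-descent : ∀ {a i} → Descent a i → NF a ~ (NF (act i a) ∷ʳ i)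
  NF-descent {a} = go a (<-wellFounded (size a))
    where
    go : ∀ a → Acc _<_ (size a) → ∀ {i} → Descent a i → NF a ~ (NF (act i a) ∷ʳ i)
    go a (acc rs) {i} dᵢ with NF-step a
    ... | inj₂ (no-descent , _) = contradiction dᵢ (no-descent i)
    ... | inj₁ (j , dⱼ , NFa≡) = ~trans (≡⇒~ NFa≡) (confluent (i ≟ j) (j ≟ next i) (i ≟ next j))
      where
      IH : ∀ {b k} → size b < size a → Descent b k → NF b ~ (NF (act k b) ∷ʳ k)
      IH lt = go _ (rs lt)
      confluent : Dec (i ≡ j) → Dec (j ≡ next i) → Dec (i ≡ next j) →
                  (NF (act j a) ∷ʳ j) ~ (NF (act i a) ∷ʳ i)
      confluent (yes refl) _          _          = ~refl
      confluent (no _)     (yes refl) _          = confluence-adjacent IH i dᵢ dⱼ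
      confluent (no _)     (no _)     (yes refl) = ~sym (confluence-adjacent IH j dⱼ dᵢ)
      confluent (no i≢j)   (no j≢i+1) (no i≢j+1) = confluence-distant IH (i≢j , i≢j+1 , j≢i+1 ∘ sym) dᵢ dⱼ

  NF-∷ʳ : ∀ a i → (NF a ∷ʳ i) ~ NF (act i a)
  NF-∷ʳ a i with descent? a i
  ... | yes dᵢ = begin
    NF a ∷ʳ i                     ≈⟨ ~-++ʳ (NF-descent dᵢ) [ i ] ⟩
    NF (act i a) ∷ʳ i ∷ʳ i        ≡⟨ ++-assoc (NF (act i a)) [ i ] [ i ] ⟩
    NF (act i a) ++ (i ∷ i ∷ [])  ≈⟨ ~-++ˡ (NF (act i a)) (cancel-move i) ⟩
    NF (act i a) ++ []            ≡⟨ ++-identityʳ (NF (act i a)) ⟩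
    NF (act i a)                  ∎
    where open SetoidReasoning (~-setoid {N})
  ... | no ¬dᵢ = ~sym (~trans (NF-descent (descent-act-ascent ¬dᵢ))
                              (≡⇒~ (cong (λ b → NF b ∷ʳ i) (act-involutive i a))))

  NF-++ : ∀ w a → (NF a ++ w) ~ NF (run w a)
  NF-++ []      a = ≡⇒~ (++-identityʳ (NF a))
  NF-++ (i ∷ w) a =
    ~trans (≡⇒~ (sym (++-assoc (NF a) [ i ] w))) (~trans (~-++ʳ (NF-∷ʳ a i) w) (NF-++ w (act i a)))

  size-zeros : size zeros ≡ 0
  size-zeros = sum-replicate-0 N

  NF-zeros : NF zeros ≡ []
  NF-zeros = cong (λ f → descend f zeros) size-zeros

  ~NF-code : ∀ w → w ~ NF (code w)
  ~NF-code w = ~trans (≡⇒~ (cong (_++ w) (sym NF-zeros))) (NF-++ w zeros)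

  ascending-≤-next^ : ∀ {a} → (∀ j → ¬ Descent a j) → ∀ t k → lookup a k ≤ lookup a (next^ t k)
  ascending-≤-next^ ¬d zero    k = ≤-refl
  ascending-≤-next^ ¬d (suc t) k = ≤-trans (ascending-≤-next^ ¬d t k) (≮⇒≥ (¬d (next^ t k) ∘ descent))

  ascending⇒zeros : ∀ {a} → (∀ j → ¬ Descent a j) → HasZero a → a ≡ zeros
  ascending⇒zeros {a} ¬d (z , a₂≡0) =
    Pointwise-≡⇒≡ (ext λ k → trans (n≤0⇒n≡0 (aₖ≤0 k)) (sym (lookup-replicate k 0)))
    where
    aₖ≤0 : ∀ k → lookup a k ≤ 0
    aₖ≤0 k = subst (lookup a k ≤_) (trans (cong (lookup a) (next^-reaches k z)) a₂≡0)
                   (ascending-≤-next^ ¬d (N ∸ toℕ k + toℕ z) k)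

  code-NF : ∀ {a} → HasZero a → code (NF a) ≡ a
  code-NF = go _ _ refl
    where
    go : ∀ f a → size a ≡ f → HasZero a → code (NF a) ≡ a
    go f a size≡f z with NF-step a
    ... | inj₂ (¬d , NFa≡[]) = trans (cong code NFa≡[]) (sym (ascending⇒zeros ¬d z))
    ... | inj₁ (j , dⱼ , NFa≡) with f
    ...   | zero  = contradiction (trans (size-act-descent dⱼ) size≡f) λ ()
    ...   | suc f = begin
      code (NF a)                    ≡⟨ cong code NFa≡ ⟩
      code (NF (act j a) ∷ʳ j)       ≡⟨ run-++ (NF (act j a)) [ j ] zeros ⟩
      act j (code (NF (act j a)))    ≡⟨ cong (act j) (go f (act j a) size≡f′ (act-HasZero j z)) ⟩
      act j (act j a)                ≡⟨ act-involutive j a ⟩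
      a                              ∎
      where
      open ≡-Reasoning
      size≡f′ = suc-injective (trans (size-act-descent dⱼ) size≡f)

  size-act-≤ : ∀ i a → size (act i a) ≤ suc (size a)
  size-act-≤ i a with descent? a i
  ... | yes dᵢ = m≤n⇒m≤1+n (<⇒≤ (size-act-< dᵢ))
  ... | no ¬dᵢ = ≤-reflexive (size-act-ascent ¬dᵢ)

  size-run-≤ : ∀ u a → size (run u a) ≤ length u + size a
  size-run-≤ []      a = ≤-refl
  size-run-≤ (i ∷ u) a = begin
    size (run u (act i a))     ≤⟨ size-run-≤ u (act i a) ⟩
    length u + size (act i a)  ≤⟨ +-monoʳ-≤ (length u) (size-act-≤ i a) ⟩
    length u + suc (size a)    ≡⟨ +-suc (length u) (size a) ⟩
    suc (length u + size a)    ∎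
    where open ≤-Reasoning

  size-code-≤ : ∀ u → size (code u) ≤ length u
  size-code-≤ u =
    subst (size (code u) ≤_) (trans (cong (length u +_) size-zeros) (+-identityʳ (length u))) (size-run-≤ u zeros)

  length-descend-≤ : ∀ f a → length (descend f a) ≤ f
  length-descend-≤ zero    a = z≤n
  length-descend-≤ (suc f) a with any? (descent? a)
  ... | yes (i , _) = subst (_≤ suc f) (sym (trans (length-++ (descend f (act i a))) (+-comm _ 1)))
                            (s≤s (length-descend-≤ f (act i a)))
  ... | no _        = z≤n

  length-NF : ∀ {a} → HasZero a → length (NF a) ≡ size a
  length-NF {a} z = ≤-antisym (length-descend-≤ (size a) a)
                              (subst (λ b → size b ≤ length (NF a)) (code-NF {a} z) (size-code-≤ (NF a)))

  isLength-code : ∀ w → IsLength N w (size (code w))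
  isLength-code w =
    (NF (code w) , ~sym (~NF-code w) , length-NF {code w} (code-HasZero w)) ,
    λ u u~w → subst (_≤ length u) (cong size (code-resp u~w)) (size-code-≤ u)

-- The embedding φ

open ≡-Reasoning

module _ (m n : ℕ) .{{_ : NonZero n}} where

  toℕ-remainder : ∀ k → toℕ (remainder {m} n k) ≡ toℕ k % n
  toℕ-remainder k = begin
    toℕ r                        ≡⟨ m<n⇒m%n≡m (toℕ<n r) ⟨
    toℕ r % n                    ≡⟨ [m+kn]%n≡m%n (toℕ r) (toℕ q) n ⟨
    (toℕ r + toℕ q * n) % n      ≡⟨ cong (_% n) (swap (toℕ r) (toℕ q) n) ⟩
    (n * toℕ q + toℕ r) % n      ≡⟨ cong (_% n) (toℕ-combine q r) ⟨
    toℕ (combine q r) % n        ≡⟨ cong (λ k → toℕ k % n) (combine-remQuot {m} n k) ⟩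
    toℕ k % n                    ∎
    where
    q = quotient {m} n k
    r = remainder {m} n k
    swap : ∀ r q n → r + q * n ≡ n * q + r
    swap = solve-∀

  remainder-next : .{{_ : NonZero (m * n)}} → ∀ k → remainder {m} n (next k) ≡ next (remainder {m} n k)
  remainder-next k = toℕ-injective (begin
    toℕ (remainder {m} n (next k))       ≡⟨ toℕ-remainder (next k) ⟩
    toℕ (next k) % n                     ≡⟨ cong (_% n) (toℕ-next k) ⟩
    suc (toℕ k) % (m * n) % n            ≡⟨ m∣n⇒o%n%m≡o%m n (m * n) (suc (toℕ k)) (n∣m*n m) ⟩
    suc (toℕ k) % n                      ≡⟨ [m+n%d]%d≡[m+n]%d 1 (toℕ k) n ⟨
    suc (toℕ k % n) % n                  ≡⟨ cong (λ x → suc x % n) (toℕ-remainder k) ⟨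
    suc (toℕ (remainder {m} n k)) % n    ≡⟨ toℕ-next (remainder {m} n k) ⟨
    toℕ (next (remainder {m} n k))       ∎)

lookup-concat-replicate : ∀ {m n} (a : Vec ℕ n) (j : Fin m) i →
                          lookup (V.concat (V.replicate m a)) (combine j i) ≡ lookup a i
lookup-concat-replicate {suc m} a Fin.zero    i = lookup-++ˡ a _ i
lookup-concat-replicate {suc m} a (Fin.suc j) i = trans (lookup-++ʳ a _ (combine j i)) (lookup-concat-replicate a j i)

sum-concat-replicate : ∀ m {n} (a : Vec ℕ n) → V.sum (V.concat (V.replicate m a)) ≡ m * V.sum a
sum-concat-replicate zero    a = refl
sum-concat-replicate (suc m) a = trans (V.sum-++ a) (cong (V.sum a +_) (sum-concat-replicate m a))

module Replication {m n : ℕ} .{{_ : NonZero m}} (2≤n : 2 ≤ n) where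

  2≤m*n : 2 ≤ m * n
  2≤m*n = ≤-trans 2≤n (m≤n*m n m)

  module Short = Codes 2≤n
  module Long  = Codes 2≤m*n
  open Short using (act) renaming (Code to ShortCode)
  open Long using (run; exchangeAt; Distant; lookup-run-clear; lookup-run-distant)

  instance
    n-nonZero : NonZero n
    n-nonZero = Short.N-nonZero
    m*n-nonZero : NonZero (m * n)
    m*n-nonZero = Long.N-nonZero

  rem : Fin (m * n) → Fin n
  rem = remainder {m} n

  repeat : ShortCode → Long.Code
  repeat a = V.concat (V.replicate m a)

  lookup-repeat : ∀ a k → lookup (repeat a) k ≡ lookup a (rem k)
  lookup-repeat a k = trans (cong (lookup (repeat a)) (sym (combine-remQuot {m} n k)))
                         (lookup-concat-replicate a (quotient {m} n k) (rem k))

  exchangeAt-repeat : ∀ a k → exchangeAt (repeat a) k ≡ Short.exchangeAt a (rem k)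
  exchangeAt-repeat a k =
    cong₂ exchange (lookup-repeat a k) (trans (lookup-repeat a (next k)) (cong (lookup a) (remainder-next m n k)))

  block : Fin n → List (Fin (m * n))
  block i = map (λ j → combine j i) (allFin m)

  rem-combine : ∀ (j : Fin m) i → rem (combine j i) ≡ i
  rem-combine j i = cong proj₂ (remQuot-combine j i)

  rem-block : ∀ {i p} → p ∈ block i → rem p ≡ i
  rem-block {i} p∈ with ∈-map⁻ (λ (j : Fin m) → combine j i) p∈
  ... | j , _ , refl = rem-combine j i

  ∈-block : ∀ {i} p → rem p ≡ i → p ∈ block i
  ∈-block {i} p refl = subst (_∈ block i) (combine-remQuot {m} n p)
                             (∈-map⁺ (λ (j : Fin m) → combine j i) (∈-allFin (quotient {m} n p)))

  rem≡⇒≢next : ∀ {p p′} → rem p ≡ rem p′ → p ≢ next p′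
  rem≡⇒≢next {p} {p′} rem≡ p≡ =
    next≢id 2≤n (rem p′) (trans (sym (remainder-next m n p′)) (trans (cong rem (sym p≡)) rem≡))

  block-distant : ∀ i → AllPairs Distant (block i)
  block-distant i = AllPairs.map⁺ (AllPairs.tabulate⁺ {n = m} {f = λ j → j} distant)
    where
    distant : ∀ {j j′ : Fin m} → j ≢ j′ → Distant (combine j i) (combine j′ i)
    distant {j} {j′} j≢j′ =
      (λ eq → j≢j′ (combine-injectiveˡ {m} {n} j i j′ i eq)) ,
      rem≡⇒≢next (trans (rem-combine j i) (sym (rem-combine j′ i))) ,
      rem≡⇒≢next (trans (rem-combine j′ i) (sym (rem-combine j i))) ∘ sym

  run-block : ∀ i a → run (block i) (repeat a) ≡ repeat (act i a)
  run-block i a = Pointwise-≡⇒≡ (ext λ k → by-cases k (rem k ≟ i) (rem k ≟ next i))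
    where
    b = run (block i) (repeat a)
    repeat-act : ∀ {k j} → rem k ≡ j → lookup (repeat (act i a)) k ≡ lookup (act i a) j
    repeat-act {k} refl = lookup-repeat (act i a) k
    exchanged : ∀ {p} → rem p ≡ i → (lookup b p , lookup b (next p)) ≡ Short.exchangeAt a i
    exchanged {p} refl = trans (lookup-run-distant (block-distant i) (∈-block p refl) (repeat a)) (exchangeAt-repeat a p)
    by-cases : ∀ k → Dec (rem k ≡ i) → Dec (rem k ≡ next i) → lookup b k ≡ lookup (repeat (act i a)) k
    by-cases k (yes rem≡i) _ = begin
      lookup b k                    ≡⟨ cong proj₁ (exchanged rem≡i) ⟩
      proj₁ (Short.exchangeAt a i)  ≡⟨ Short.lookup-act-at i a ⟨
      lookup (act i a) i            ≡⟨ repeat-act rem≡i ⟨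
      lookup (repeat (act i a)) k   ∎
    by-cases k (no _) (yes rem≡i+1) = begin
      lookup b k                    ≡⟨ cong (lookup b) (next-prev k) ⟨
      lookup b (next p)             ≡⟨ cong proj₂ (exchanged remp≡i) ⟩
      proj₂ (Short.exchangeAt a i)  ≡⟨ Short.lookup-act-next i a ⟨
      lookup (act i a) (next i)     ≡⟨ repeat-act rem≡i+1 ⟨
      lookup (repeat (act i a)) k   ∎
      where
      p = prev k
      remp≡i : rem p ≡ i
      remp≡i = next-injective (trans (sym (remainder-next m n p)) (trans (cong rem (next-prev k)) rem≡i+1))
    by-cases k (no rem≢i) (no rem≢i+1) = begin
      lookup b k                    ≡⟨ lookup-run-clear (block i) (repeat a) (All.tabulate clear) ⟩
      lookup (repeat a) k           ≡⟨ lookup-repeat a k ⟩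
      lookup a (rem k)              ≡⟨ Short.lookup-act-other i a rem≢i rem≢i+1 ⟨
      lookup (act i a) (rem k)      ≡⟨ repeat-act refl ⟨
      lookup (repeat (act i a)) k   ∎
      where
      clear : ∀ {p} → p ∈ block i → Long.Clear k p
      clear {p} p∈ =
        (λ k≡p → rem≢i (trans (cong rem k≡p) (rem-block p∈))) ,
        (λ k≡p+1 → rem≢i+1 (trans (cong rem k≡p+1) (trans (remainder-next m n p) (cong next (rem-block p∈)))))

  run-φ : ∀ w a → run (φ n m w) (repeat a) ≡ repeat (Short.run w a)
  run-φ []      a = refl
  run-φ (i ∷ w) a = begin
    run (block i ++ φ n m w) (repeat a)       ≡⟨ Long.run-++ (block i) (φ n m w) (repeat a) ⟩
    run (φ n m w) (run (block i) (repeat a))  ≡⟨ cong (run (φ n m w)) (run-block i a) ⟩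
    run (φ n m w) (repeat (act i a))          ≡⟨ run-φ w (act i a) ⟩
    repeat (Short.run w (act i a))            ∎

  repeat-zeros : repeat Short.zeros ≡ Long.zeros
  repeat-zeros = Pointwise-≡⇒≡ (ext λ k →
    trans (lookup-repeat Short.zeros k) (trans (lookup-replicate (rem k) 0) (sym (lookup-replicate k 0))))

  code-φ : ∀ w → Long.code (φ n m w) ≡ repeat (Short.code w)
  code-φ w = trans (cong (run (φ n m w)) (sym repeat-zeros)) (run-φ w Short.zeros)

  isLength-φ : ∀ w → IsLength (m * n) (φ n m w) (m * Short.size (Short.code w))
  isLength-φ w = subst (IsLength (m * n) (φ n m w)) size-code-φ (Long.isLength-code (φ n m w))
    where
    size-code-φ : Long.size (Long.code (φ n m w)) ≡ m * Short.size (Short.code w)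
    size-code-φ = trans (cong V.sum (code-φ w)) (sum-concat-replicate m (Short.code w))

-- Enumerations of power series

-- f is the generating series Σ_{P x} q^{w x}: degree by degree, a duplicate-free list of the
-- objects of that weight.
record Enumeration {A : Set} (f : Series) (P : A → Set) (w : A → ℕ) : Set where
  field
    elems          : ℕ → List A
    length-elems   : ∀ d → length (elems d) ≡ f d
    unique-elems   : ∀ d → Unique (elems d)
    sound-elems    : ∀ d {x} → x ∈ elems d → P x × w x ≡ d
    complete-elems : ∀ d {x} → P x → w x ≡ d → x ∈ elems d

mono-≡ : ∀ d → mono d d ≡ 1
mono-≡ zero    = refl
mono-≡ (suc d) = mono-≡ d

mono-≢ : ∀ {e d} → e ≢ d → mono e d ≡ 0
mono-≢ {zero}  {zero}  e≢d = contradiction refl e≢d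
mono-≢ {zero}  {suc d} _   = refl
mono-≢ {suc e} {zero}  _   = refl
mono-≢ {suc e} {suc d} e≢d = mono-≢ (e≢d ∘ cong suc)

length-filter≡sum-mono : ∀ (w : ℕ → ℕ) d ts →
                         length (filter (λ t → w t ≟ℕ d) ts) ≡ sum (map (λ t → mono (w t) d) ts)
length-filter≡sum-mono w d []       = refl
length-filter≡sum-mono w d (t ∷ ts) with w t ≟ℕ d
... | yes wt≡d = begin
  length (filter (λ t → w t ≟ℕ d) (t ∷ ts))         ≡⟨ cong length (filter-accept (λ t → w t ≟ℕ d) wt≡d) ⟩
  suc (length (filter (λ t → w t ≟ℕ d) ts))         ≡⟨ cong suc (length-filter≡sum-mono w d ts) ⟩
  1 + sum (map (λ t → mono (w t) d) ts)             ≡⟨ cong (_+ _) mono-wt≡1 ⟨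
  mono (w t) d + sum (map (λ t → mono (w t) d) ts)  ∎
  where
  mono-wt≡1 : mono (w t) d ≡ 1
  mono-wt≡1 = trans (cong (λ e → mono e d) wt≡d) (mono-≡ d)
... | no wt≢d = begin
  length (filter (λ t → w t ≟ℕ d) (t ∷ ts))         ≡⟨ cong length (filter-reject (λ t → w t ≟ℕ d) wt≢d) ⟩
  length (filter (λ t → w t ≟ℕ d) ts)               ≡⟨ length-filter≡sum-mono w d ts ⟩
  sum (map (λ t → mono (w t) d) ts)                 ≡⟨ cong (_+ _) (mono-≢ wt≢d) ⟨
  mono (w t) d + sum (map (λ t → mono (w t) d) ts)  ∎

filter-enumeration : ∀ {P : ℕ → Set} (w : ℕ → ℕ) (cands : ℕ → List ℕ) →
  (∀ d → Unique (cands d)) →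
  (∀ d {t} → t ∈ cands d → w t ≡ d → P t) →
  (∀ d {t} → P t → w t ≡ d → t ∈ cands d) →
  Enumeration (λ d → sum (map (λ t → mono (w t) d) (cands d))) P w
filter-enumeration w cands unique sound complete = record
  { elems          = λ d → filter (λ t → w t ≟ℕ d) (cands d)
  ; length-elems   = λ d → length-filter≡sum-mono w d (cands d)
  ; unique-elems   = λ d → Unique.filter⁺ (λ t → w t ≟ℕ d) (unique d)
  ; sound-elems    = λ d t∈ → let (t∈cands , wt≡d) = ∈-filter⁻ (λ t → w t ≟ℕ d) t∈
                              in sound d t∈cands wt≡d , wt≡d
  ; complete-elems = λ d Pt wt≡d → ∈-filter⁺ (λ t → w t ≟ℕ d) (complete d Pt wt≡d) wt≡d
  }

bracket-enumeration : ∀ m k → Enumeration (bracket m k) (_< k) (_* m)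
bracket-enumeration m k =
  filter-enumeration (_* m) (λ _ → upTo k) (λ _ → Unique.upTo⁺ k)
    (λ _ t∈ _ → ∈-upTo⁻ t∈) (λ _ t<k _ → ∈-upTo⁺ t<k)

geo-enumeration : ∀ a .{{_ : NonZero a}} → Enumeration (geo a) (λ _ → ⊤) (_* a)
geo-enumeration a =
  filter-enumeration (_* a) (λ d → upTo (suc d)) (λ d → Unique.upTo⁺ (suc d)) (λ _ _ _ → tt)
    (λ d {t} _ ta≡d → ∈-upTo⁺ (s≤s (subst (t ≤_) ta≡d (m≤m*n t a))))

length-concatMap : ∀ {A B : Set} (f : A → List B) xs → length (concatMap f xs) ≡ sum (map (length ∘ f) xs)
length-concatMap f []       = refl
length-concatMap f (x ∷ xs) = trans (length-++ (f x)) (cong (length (f x) +_) (length-concatMap f xs))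

length-cartesianProduct : ∀ {A B : Set} (xs : List A) (ys : List B) →
                          length (cartesianProduct xs ys) ≡ length xs * length ys
length-cartesianProduct []       ys = refl
length-cartesianProduct (x ∷ xs) ys = begin
  length (map (x ,_) ys ++ cartesianProduct xs ys)          ≡⟨ length-++ (map (x ,_) ys) ⟩
  length (map (x ,_) ys) + length (cartesianProduct xs ys)  ≡⟨ cong₂ _+_ (length-map (x ,_) ys)
                                                                          (length-cartesianProduct xs ys) ⟩
  length ys + length xs * length ys                         ∎

Unique⇒AllPairs-¬ : ∀ {A : Set} {R : A → A → Set} {xs} → (∀ {x y} → x ∈ xs → y ∈ xs → R x y → x ≡ y) →
                     Unique xs → AllPairs (λ x y → ¬ R x y) xs
Unique⇒AllPairs-¬ R⇒≡ []          = []
Unique⇒AllPairs-¬ R⇒≡ (x∉ ∷ uniq) =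
  All.tabulate (λ y∈ Rxy → All.lookup x∉ y∈ (R⇒≡ (here refl) (there y∈) Rxy)) ∷
  Unique⇒AllPairs-¬ (λ x∈ y∈ → R⇒≡ (there x∈) (there y∈)) uniq

module _ {A B : Set} {f g : Series} {P : A → Set} {Q : B → Set} {v : A → ℕ} {w : B → ℕ} where

  _⊗_ : Enumeration f P v → Enumeration g Q w → Enumeration (f ⋆ g) (λ (x , y) → P x × Q y) (λ (x , y) → v x + w y)
  E ⊗ F = record
    { elems          = elems
    ; length-elems   = length-elems
    ; unique-elems   = unique-elems
    ; sound-elems    = sound-elems
    ; complete-elems = complete-elems
    }
    where
    module E = Enumeration E
    module F = Enumeration F

    split : ℕ → ℕ → List (A × B)
    split d t = cartesianProduct (E.elems t) (F.elems (d ∸ t))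

    elems : ℕ → List (A × B)
    elems d = concatMap (split d) (upTo (suc d))

    length-elems : ∀ d → length (elems d) ≡ (f ⋆ g) d
    length-elems d = trans (length-concatMap (split d) (upTo (suc d))) (cong sum (map-cong length-split (upTo (suc d))))
      where
      length-split : ∀ t → length (split d t) ≡ f t * g (d ∸ t)
      length-split t = trans (length-cartesianProduct (E.elems t) (F.elems (d ∸ t)))
                             (cong₂ _*_ (E.length-elems t) (F.length-elems (d ∸ t)))

    ∈-split⁻ : ∀ {d t x y} → (x , y) ∈ split d t → x ∈ E.elems t × y ∈ F.elems (d ∸ t)
    ∈-split⁻ {d} {t} = ∈-cartesianProduct⁻ (E.elems t) (F.elems (d ∸ t))

    unique-elems : ∀ d → Unique (elems d)
    unique-elems d = Unique.concat⁺
      (All.map⁺ (All.tabulate λ {t} _ → Unique.cartesianProduct⁺ (E.unique-elems t) (F.unique-elems (d ∸ t))))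
      (AllPairs.map⁺ (AllPairs.map disjoint (Unique.upTo⁺ (suc d))))
      where
      disjoint : ∀ {t t′} → t ≢ t′ → ∀ {xy} → ¬ (xy ∈ split d t × xy ∈ split d t′)
      weight-split : ∀ {t x y} → (x , y) ∈ split d t → v x ≡ t
      weight-split xy∈ = proj₂ (E.sound-elems _ (proj₁ (∈-split⁻ xy∈)))
      disjoint t≢t′ {x , y} (∈t , ∈t′) = t≢t′ (trans (sym (weight-split ∈t)) (weight-split ∈t′))

    sound-elems : ∀ d {xy} → xy ∈ elems d → (P (proj₁ xy) × Q (proj₂ xy)) × v (proj₁ xy) + w (proj₂ xy) ≡ d
    sound-elems d {x , y} xy∈ with find (∈-concatMap⁻ (split d) xy∈)
    ... | t , t∈ , xy∈split with ∈-split⁻ xy∈split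
    ...   | x∈ , y∈ with E.sound-elems t x∈ | F.sound-elems (d ∸ t) y∈
    ...     | Px , refl | Qy , wy≡ = (Px , Qy) , trans (cong (v x +_) wy≡) (m+[n∸m]≡n (≤-pred (∈-upTo⁻ t∈)))

    complete-elems : ∀ d {xy} → P (proj₁ xy) × Q (proj₂ xy) → v (proj₁ xy) + w (proj₂ xy) ≡ d → xy ∈ elems d
    complete-elems d {x , y} (Px , Qy) refl =
      ∈-concatMap⁺ (split d) (lose (∈-upTo⁺ (s≤s (m≤m+n (v x) (w y))))
        (∈-cartesianProduct⁺ (E.complete-elems (v x) Px refl) (F.complete-elems _ Qy (sym (m+n∸m≡n (v x) (w y))))))

transport : ∀ {A B : Set} {f : Series} {P : A → Set} {Q : B → Set} {v : A → ℕ} {w : B → ℕ}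
  (to : A → B) (from : B → A) →
  (∀ {x} → P x → Q (to x) × from (to x) ≡ x × w (to x) ≡ v x) →
  (∀ {y} → Q y → P (from y) × to (from y) ≡ y) →
  Enumeration f P v → Enumeration f Q w
transport {Q = Q} {v} {w} to from to-ok from-ok E = record
  { elems          = λ d → map to (E.elems d)
  ; length-elems   = λ d → trans (length-map to (E.elems d)) (E.length-elems d)
  ; unique-elems   = λ d → AllPairs.map⁺ (Unique⇒AllPairs-¬ (injective d) (E.unique-elems d))
  ; sound-elems    = sound
  ; complete-elems = complete
  }
  where
  module E = Enumeration E
  from-to : ∀ {d x} → x ∈ E.elems d → from (to x) ≡ x
  from-to x∈ = proj₁ (proj₂ (to-ok (proj₁ (E.sound-elems _ x∈))))
  injective : ∀ d {x y} → x ∈ E.elems d → y ∈ E.elems d → to x ≡ to y → x ≡ y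
  injective d x∈ y∈ eq = trans (sym (from-to x∈)) (trans (cong from eq) (from-to y∈))
  sound : ∀ d {y} → y ∈ map to (E.elems d) → Q y × w y ≡ d
  sound d y∈ with find (Any.map⁻ y∈)
  ... | x , x∈ , refl with E.sound-elems d x∈
  ...   | Px , vx≡d = proj₁ (to-ok Px) , trans (proj₂ (proj₂ (to-ok Px))) vx≡d
  complete : ∀ d {y} → Q y → w y ≡ d → y ∈ map to (E.elems d)
  complete d {y} Qy wy≡d = subst (_∈ map to (E.elems d)) to-from (∈-map⁺ to (E.complete-elems d P-from v-from≡d))
    where
    P-from = proj₁ (from-ok Qy)
    to-from = proj₂ (from-ok Qy)
    v-from≡d : v (from y) ≡ d
    v-from≡d = trans (sym (proj₂ (proj₂ (to-ok P-from)))) (trans (cong w to-from) wy≡d)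

nil-enumeration : ∀ {R : ℕ → ℕ → Set} (w : ℕ → ℕ → ℕ) → Enumeration one (Pointwise R []) (sum ∘ zipWith w [])
nil-enumeration {R} w = record
  { elems          = elems
  ; length-elems   = λ { zero → refl ; (suc d) → refl }
  ; unique-elems   = λ { zero → [] ∷ [] ; (suc d) → [] }
  ; sound-elems    = λ { zero (here refl) → [] , refl }
  ; complete-elems = λ { zero [] _ → here refl }
  }
  where
  elems : ℕ → List (List ℕ)
  elems zero    = [ [] ]
  elems (suc d) = []

products : ∀ (F : ℕ → Series) {R : ℕ → ℕ → Set} (w : ℕ → ℕ → ℕ) → (∀ k → Enumeration (F k) (R k) (w k)) →
           ∀ ks → Enumeration (prodS (map F ks)) (Pointwise R ks) (λ xs → sum (zipWith w ks xs))
products F w E []           = nil-enumeration w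
products F {R} w E (k ∷ ks) =
  transport (uncurry _∷_) uncons (λ (Rx , Rxs) → Rx ∷ Rxs , refl , refl) from-ok (E k ⊗ products F w E ks)
  where
  uncons : List ℕ → ℕ × List ℕ
  uncons []       = 0 , []
  uncons (x ∷ xs) = x , xs
  from-ok : ∀ {xs} → Pointwise R (k ∷ ks) xs →
            (R k (proj₁ (uncons xs)) × Pointwise R ks (proj₂ (uncons xs))) × uncurry _∷_ (uncons xs) ≡ xs
  from-ok (Rx ∷ Rxs) = (Rx , Rxs) , refl

-- Codes with a zero entry

-- insertZero p x = (x₀+1, …, x_{p-1}+1, 0, x_p, …); splitAtZero inverts it at the first
-- zero (on lists without a zero, and for p > length x, the results are junk).
insertZero : ℕ → List ℕ → List ℕ
insertZero zero    xs       = 0 ∷ xs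
insertZero (suc p) []       = [ 0 ]
insertZero (suc p) (x ∷ xs) = suc x ∷ insertZero p xs

splitAtZero : List ℕ → ℕ × List ℕ
splitAtZero []           = 0 , []
splitAtZero (zero ∷ xs)  = 0 , xs
splitAtZero (suc x ∷ xs) = suc (proj₁ (splitAtZero xs)) , x ∷ proj₂ (splitAtZero xs)

splitAtZero-insertZero : ∀ {p} xs → p ≤ length xs → splitAtZero (insertZero p xs) ≡ (p , xs)
splitAtZero-insertZero {zero}  xs       _         = refl
splitAtZero-insertZero {suc p} (x ∷ xs) (s≤s p≤) rewrite splitAtZero-insertZero xs p≤ = refl

insertZero-splitAtZero : ∀ {xs} → 0 ∈ xs → uncurry insertZero (splitAtZero xs) ≡ xs
insertZero-splitAtZero {zero ∷ xs}  _          = refl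
insertZero-splitAtZero {suc x ∷ xs} (there 0∈) = cong (suc x ∷_) (insertZero-splitAtZero 0∈)

splitAtZero-≤ : ∀ {xs} → 0 ∈ xs → proj₁ (splitAtZero xs) ≤ length (proj₂ (splitAtZero xs))
splitAtZero-≤ {zero ∷ xs}  _          = z≤n
splitAtZero-≤ {suc x ∷ xs} (there 0∈) = s≤s (splitAtZero-≤ 0∈)

length-insertZero : ∀ p xs → length (insertZero p xs) ≡ suc (length xs)
length-insertZero zero    xs       = refl
length-insertZero (suc p) []       = refl
length-insertZero (suc p) (x ∷ xs) = cong suc (length-insertZero p xs)

sum-insertZero : ∀ {p} xs → p ≤ length xs → sum (insertZero p xs) ≡ p + sum xs
sum-insertZero {zero}  xs       _        = refl
sum-insertZero {suc p} (x ∷ xs) (s≤s p≤) = begin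
  suc x + sum (insertZero p xs)  ≡⟨ cong (suc x +_) (sum-insertZero xs p≤) ⟩
  suc x + (p + sum xs)           ≡⟨ shuffle x p (sum xs) ⟩
  suc p + (x + sum xs)           ∎
  where
  shuffle : ∀ x p s → suc x + (p + s) ≡ suc p + (x + s)
  shuffle = solve-∀

0∈insertZero : ∀ p xs → 0 ∈ insertZero p xs
0∈insertZero zero    xs       = here refl
0∈insertZero (suc p) []       = here refl
0∈insertZero (suc p) (x ∷ xs) = there (0∈insertZero p xs)

Digits : List ℕ → List ℕ → Set
Digits = Pointwise (λ k e → e < suc k)

SameLength : List ℕ → List ℕ → Set
SameLength = Pointwise (λ _ _ → ⊤)

digits : List ℕ → List ℕ → List ℕ → List ℕ
digits (k ∷ ks) (e ∷ es) (g ∷ gs) = e + g * suc k ∷ digits ks es gs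
digits _        _        _        = []

undigits : List ℕ → List ℕ → List ℕ × List ℕ
undigits (k ∷ ks) (x ∷ xs) = x % suc k ∷ proj₁ (undigits ks xs) , x / suc k ∷ proj₂ (undigits ks xs)
undigits _        _        = [] , []

undigits-digits : ∀ {ks es gs} → Digits ks es → SameLength ks gs → undigits ks (digits ks es gs) ≡ (es , gs)
undigits-digits [] [] = refl
undigits-digits {k ∷ ks} {e ∷ es} {g ∷ gs} (e<k+1 ∷ des) (_ ∷ sgs) =
  cong₂ (λ (r , q) (rs , qs) → r ∷ rs , q ∷ qs) (cong₂ _,_ rem≡ quot≡) (undigits-digits des sgs)
  where
  rem≡ : (e + g * suc k) % suc k ≡ e
  rem≡ = trans ([m+kn]%n≡m%n e g (suc k)) (m<n⇒m%n≡m e<k+1)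
  quot≡ : (e + g * suc k) / suc k ≡ g
  quot≡ = trans (+-distrib-/-∣ʳ e (n∣m*n g)) (cong₂ _+_ (m<n⇒m/n≡0 e<k+1) (m*n/n≡m g (suc k)))

digits-undigits : ∀ ks {xs} → length xs ≡ length ks → uncurry (digits ks) (undigits ks xs) ≡ xs
digits-undigits []       {[]}     _  = refl
digits-undigits (k ∷ ks) {x ∷ xs} eq =
  cong₂ _∷_ (sym (m≡m%n+[m/n]*n x (suc k))) (digits-undigits ks (suc-injective eq))

undigits-valid : ∀ ks {xs} → length xs ≡ length ks →
                 Digits ks (proj₁ (undigits ks xs)) × SameLength ks (proj₂ (undigits ks xs))
undigits-valid []       {[]}     _  = [] , []
undigits-valid (k ∷ ks) {x ∷ xs} eq with undigits-valid ks (suc-injective eq)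
... | des , sgs = m%n<n x (suc k) ∷ des , tt ∷ sgs

length-digits : ∀ {ks es gs} → Digits ks es → SameLength ks gs → length (digits ks es gs) ≡ length ks
length-digits []          []         = refl
length-digits (_ ∷ des)   (_ ∷ sgs)  = cong suc (length-digits des sgs)

sum-digits : ∀ m {ks es gs} → Digits ks es → SameLength ks gs →
  m * sum (digits ks es gs) ≡ sum (zipWith (λ _ e → e * m) ks es) + sum (zipWith (λ k g → g * (suc k * m)) ks gs)
sum-digits m [] [] = *-zeroʳ m
sum-digits m {k ∷ ks} {e ∷ es} {g ∷ gs} (_ ∷ des) (_ ∷ sgs) = begin
  m * (e + g * suc k + sum (digits ks es gs))     ≡⟨ *-distribˡ-+ m (e + g * suc k) _ ⟩
  m * (e + g * suc k) + m * sum (digits ks es gs) ≡⟨ cong (m * (e + g * suc k) +_) (sum-digits m des sgs) ⟩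
  m * (e + g * suc k) + (E + G)                   ≡⟨ regroup m e g k E G ⟩
  (e * m + E) + (g * (suc k * m) + G)             ∎
  where
  E = sum (zipWith (λ _ e → e * m) ks es)
  G = sum (zipWith (λ k g → g * (suc k * m)) ks gs)
  regroup : ∀ m e g k E G → m * (e + g * suc k) + (E + G) ≡ (e * m + E) + (g * (suc k * m) + G)
  regroup = solve-∀

splitLast : List ℕ → List ℕ × ℕ
splitLast []           = [] , 0
splitLast (x ∷ [])     = [] , x
splitLast (x ∷ y ∷ xs) = x ∷ proj₁ (splitLast (y ∷ xs)) , proj₂ (splitLast (y ∷ xs))

splitLast-∷ʳ : ∀ xs x → splitLast (xs ∷ʳ x) ≡ (xs , x)
splitLast-∷ʳ []           x = refl
splitLast-∷ʳ (y ∷ [])     x = refl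
splitLast-∷ʳ (y ∷ z ∷ xs) x rewrite splitLast-∷ʳ (z ∷ xs) x = refl

Pointwise-∷ʳ⁻ : ∀ {R : ℕ → ℕ → Set} ks k {es} → Pointwise R (ks ∷ʳ k) es →
                ∃₂ λ es′ e → es ≡ es′ ∷ʳ e × Pointwise R ks es′ × R k e
Pointwise-∷ʳ⁻ []       k (r ∷ [])  = [] , _ , refl , [] , r
Pointwise-∷ʳ⁻ (_ ∷ ks) k (r ∷ rs) with Pointwise-∷ʳ⁻ ks k rs
... | es′ , e , refl , rs′ , r′ = _ ∷ es′ , e , refl , r ∷ rs′ , r′

sum-zipWith-∷ʳ : ∀ (w : ℕ → ℕ → ℕ) {R : ℕ → ℕ → Set} {ks es} k e → Pointwise R ks es →
                 sum (zipWith w (ks ∷ʳ k) (es ∷ʳ e)) ≡ sum (zipWith w ks es) + w k e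
sum-zipWith-∷ʳ w k e []                  = +-comm (w k e) 0
sum-zipWith-∷ʳ w {ks = k′ ∷ _} {x ∷ _} k e (_ ∷ rs) =
  trans (cong (w k′ x +_) (sum-zipWith-∷ʳ w k e rs)) (sym (+-assoc (w k′ x) _ _))

RHS-reindex : ∀ n m → RHS (suc n) m ≡
  prodS (map (λ t → bracket m (suc t)) (upTo (suc n))) ⋆ prodS (map (λ k → geo (suc k * m)) (upTo n))
RHS-reindex n m =
  cong (λ gs → prodS (map (λ t → bracket m (suc t)) (upTo (suc n))) ⋆ prodS gs)
       (trans (map-applyUpTo suc (λ t → geo (t * m)) n) (sym (map-upTo (λ k → geo (suc k * m)) n)))

module ZeroLists (n m : ℕ) .{{_ : NonZero m}} where

  Tuple : Set
  Tuple = List ℕ × List ℕ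

  -- es picks the monomial q^{e m} from each [t+1]_{q^m}, t ≤ n, and gs the monomial
  -- q^{g (k+1) m} from each 1/(1 - q^{(k+1) m}), k < n.
  ValidTuple : Tuple → Set
  ValidTuple (es , gs) = Pointwise (λ t e → e < suc t) (upTo (suc n)) es × SameLength (upTo n) gs

  weight : Tuple → ℕ
  weight (es , gs) =
    sum (zipWith (λ _ e → e * m) (upTo (suc n)) es) + sum (zipWith (λ k g → g * (suc k * m)) (upTo n) gs)

  tuples-enumeration : Enumeration (RHS (suc n) m) ValidTuple weight
  tuples-enumeration = subst (λ f → Enumeration f ValidTuple weight) (sym (RHS-reindex n m))
    (products (λ t → bracket m (suc t)) (λ _ e → e * m) (λ t → bracket-enumeration m (suc t)) (upTo (suc n)) ⊗
     products (λ k → geo (suc k * m)) (λ k g → g * (suc k * m))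
              (λ k → geo-enumeration (suc k * m) {{m*n≢0 (suc k) m}}) (upTo n))

  encode : Tuple → List ℕ
  encode (es , gs) = insertZero (proj₂ (splitLast es)) (digits (upTo n) (proj₁ (splitLast es)) gs)

  decode : List ℕ → Tuple
  decode xs = proj₁ (undigits (upTo n) ys) ∷ʳ p , proj₂ (undigits (upTo n) ys)
    where
    p = proj₁ (splitAtZero xs)
    ys = proj₂ (splitAtZero xs)

  ZeroList : List ℕ → Set
  ZeroList xs = length xs ≡ suc n × 0 ∈ xs

  sum-encode : ∀ {es′ p gs} → Digits (upTo n) es′ → SameLength (upTo n) gs → p ≤ n →
               m * sum (insertZero p (digits (upTo n) es′ gs)) ≡ weight (es′ ∷ʳ p , gs)
  sum-encode {es′} {p} {gs} digits-es′ same-gs p≤n = begin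
    m * sum (insertZero p ds)                                   ≡⟨ cong (m *_) (sum-insertZero ds p≤) ⟩
    m * (p + sum ds)                                            ≡⟨ *-distribˡ-+ m p (sum ds) ⟩
    m * p + m * sum ds                                          ≡⟨ cong₂ _+_ (*-comm m p) (sum-digits m digits-es′ same-gs) ⟩
    p * m + (E + G)                                             ≡⟨ regroup (p * m) E G ⟩
    (E + p * m) + G                                             ≡⟨ cong (_+ G) (sum-zipWith-∷ʳ (λ _ e → e * m) n p digits-es′) ⟨
    sum (zipWith (λ _ e → e * m) (upTo n ∷ʳ n) (es′ ∷ʳ p)) + G  ≡⟨ cong (λ ks → sum (zipWith (λ _ e → e * m) ks (es′ ∷ʳ p)) + G)
                                                                         (upTo-∷ʳ n) ⟩
    weight (es′ ∷ʳ p , gs)                                      ∎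
    where
    open ≡-Reasoning
    ds = digits (upTo n) es′ gs
    E = sum (zipWith (λ _ e → e * m) (upTo n) es′)
    G = sum (zipWith (λ k g → g * (suc k * m)) (upTo n) gs)
    p≤ : p ≤ length ds
    p≤ = subst (p ≤_) (sym (trans (length-digits digits-es′ same-gs) (length-upTo n))) p≤n
    regroup : ∀ a b c → a + (b + c) ≡ (b + a) + c
    regroup = solve-∀

  encode-ok : ∀ {t} → ValidTuple t → ZeroList (encode t) × decode (encode t) ≡ t × m * sum (encode t) ≡ weight t
  encode-ok {es , gs} (valid-es , same-gs)
    with Pointwise-∷ʳ⁻ (upTo n) n (subst (λ ks → Pointwise (λ t e → e < suc t) ks es) (sym (upTo-∷ʳ n)) valid-es)
  ... | es′ , p , refl , digits-es′ , s≤s p≤n rewrite splitLast-∷ʳ es′ p =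
    (trans (length-insertZero p ds) (cong suc length-ds) , 0∈insertZero p ds) ,
    trans (cong (λ (p , ys) → proj₁ (undigits (upTo n) ys) ∷ʳ p , proj₂ (undigits (upTo n) ys))
                (splitAtZero-insertZero ds (subst (p ≤_) (sym length-ds) p≤n)))
          (cong (λ (es′ , gs) → es′ ∷ʳ p , gs) (undigits-digits digits-es′ same-gs)) ,
    sum-encode digits-es′ same-gs p≤n
    where
    ds = digits (upTo n) es′ gs
    length-ds : length ds ≡ n
    length-ds = trans (length-digits digits-es′ same-gs) (length-upTo n)

  decode-ok : ∀ {xs} → ZeroList xs → ValidTuple (decode xs) × encode (decode xs) ≡ xs
  decode-ok {xs} (length-xs , 0∈xs) =
    (subst (λ ks → Pointwise _ ks (es′ ∷ʳ p)) (upTo-∷ʳ n) (Pointwise.++⁺ digits-es′ (p<1+n ∷ [])) , same-gs) ,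
    (begin
      encode (es′ ∷ʳ p , gs)                 ≡⟨ cong (λ (es′ , p) → insertZero p (digits (upTo n) es′ gs))
                                                     (splitLast-∷ʳ es′ p) ⟩
      insertZero p (digits (upTo n) es′ gs)  ≡⟨ cong (insertZero p) (digits-undigits (upTo n) length-ys) ⟩
      insertZero p ys                        ≡⟨ insertZero-splitAtZero 0∈xs ⟩
      xs                                     ∎)
    where
    p = proj₁ (splitAtZero xs)
    ys = proj₂ (splitAtZero xs)
    es′ = proj₁ (undigits (upTo n) ys)
    gs = proj₂ (undigits (upTo n) ys)
    length-ys : length ys ≡ length (upTo n)
    length-ys = suc-injective (begin
      suc (length ys)            ≡⟨ length-insertZero p ys ⟨
      length (insertZero p ys)   ≡⟨ cong length (insertZero-splitAtZero 0∈xs) ⟩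
      length xs                  ≡⟨ length-xs ⟩
      suc n                      ≡⟨ cong suc (length-upTo n) ⟨
      suc (length (upTo n))      ∎)
    digits-es′ = proj₁ (undigits-valid (upTo n) length-ys)
    same-gs = proj₂ (undigits-valid (upTo n) length-ys)
    p<1+n : p < suc n
    p<1+n = s≤s (subst (p ≤_) (trans length-ys (length-upTo n)) (splitAtZero-≤ 0∈xs))

  zero-lists-enumeration : Enumeration (RHS (suc n) m) ZeroList (λ xs → m * sum xs)
  zero-lists-enumeration = transport encode decode encode-ok decode-ok tuples-enumeration

HasZero⇒0∈toList : ∀ {n} {a : Vec ℕ n} → HasZero a → 0 ∈ toList a
HasZero⇒0∈toList {a = a} (k , aₖ≡0) = ∈-toList⁺ (subst (_∈ᵥ a) aₖ≡0 (∈-lookup k a))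

0∈toList⇒HasZero : ∀ {n} {a : Vec ℕ n} → 0 ∈ toList a → HasZero a
0∈toList⇒HasZero 0∈ = VecAny.index (∈-toList⁻ 0∈) , sym (VecAny.lookup-index (∈-toList⁻ 0∈))

-- Pads with zeros or truncates; only used on lists of length n.
toVec : ∀ n → List ℕ → Vec ℕ n
toVec zero    _        = V.[]
toVec (suc n) []       = 0 V.∷ toVec n []
toVec (suc n) (x ∷ xs) = x V.∷ toVec n xs

toList-toVec : ∀ {n} xs → length xs ≡ n → toList (toVec n xs) ≡ xs
toList-toVec []       refl = refl
toList-toVec (x ∷ xs) refl = cong (x ∷_) (toList-toVec xs refl)

toVec-toList : ∀ {n} (a : Vec ℕ n) → toVec n (toList a) ≡ a
toVec-toList V.[]      = refl
toVec-toList (x V.∷ a) = cong (x V.∷_) (toVec-toList a)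

sum-toList : ∀ {n} (a : Vec ℕ n) → sum (toList a) ≡ V.sum a
sum-toList V.[]      = refl
sum-toList (x V.∷ a) = cong (x +_) (sum-toList a)

zero-codes-enumeration : ∀ n m .{{_ : NonZero m}} →
                         Enumeration (RHS (suc n) m) HasZero (λ (a : Vec ℕ (suc n)) → m * V.sum a)
zero-codes-enumeration n m = transport (toVec (suc n)) toList to-ok from-ok (ZeroLists.zero-lists-enumeration n m)
  where
  to-ok : ∀ {xs} → ZeroLists.ZeroList n m xs →
          HasZero (toVec (suc n) xs) × toList (toVec (suc n) xs) ≡ xs × m * V.sum (toVec (suc n) xs) ≡ m * sum xs
  to-ok {xs} (length-xs , 0∈xs) =
    0∈toList⇒HasZero (subst (0 ∈_) (sym roundtrip) 0∈xs) , roundtrip ,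
    cong (m *_) (trans (sym (sum-toList (toVec (suc n) xs))) (cong sum roundtrip))
    where
    roundtrip = toList-toVec xs length-xs
  from-ok : ∀ {a : Vec ℕ (suc n)} → HasZero a → ZeroLists.ZeroList n m (toList a) × toVec (suc n) (toList a) ≡ a
  from-ok {a} z = (length-toList a , HasZero⇒0∈toList z) , toVec-toList a
-- Counting group elements

hasCount-by-invariant : ∀ {N} {A : Set} {f : Series} {Q : A → Set} {w : A → ℕ} {P : List (Fin N) → Set}
  (E : Enumeration f Q w) (nf : A → List (Fin N)) (code : List (Fin N) → A) →
  (∀ {u v} → u ~ v → code u ≡ code v) → (∀ {x} → Q x → code (nf x) ≡ x) → ∀ d →
  (∀ {x} → Q x → w x ≡ d → P (nf x)) → (∀ {u} → P u → Q (code u) × w (code u) ≡ d × u ~ nf (code u)) →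
  HasCount P (f d)
hasCount-by-invariant E nf code code-resp code-nf d sound complete =
  map nf (E.elems d) ,
  trans (length-map nf (E.elems d)) (E.length-elems d) ,
  All.map⁺ (All.tabulate λ x∈ → uncurry sound (E.sound-elems d x∈)) ,
  AllPairs.map⁺ (Unique⇒AllPairs-¬ inequivalent (E.unique-elems d)) ,
  λ u Pu → let (Qcu , wcu≡d , u~) = complete Pu in
           Any.map (λ nfcu≡ → subst (u ~_) nfcu≡ u~) (∈-map⁺ nf (E.complete-elems d Qcu wcu≡d))
  where
  module E = Enumeration E
  inequivalent : ∀ {x y} → x ∈ E.elems d → y ∈ E.elems d → nf x ~ nf y → x ≡ y
  inequivalent x∈ y∈ nfx~nfy =
    trans (sym (code-nf (proj₁ (E.sound-elems d x∈)))) (trans (code-resp nfx~nfy) (code-nf (proj₁ (E.sound-elems d y∈))))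

theorem1p7 : (n m : ℕ) → 2 ≤ n → 2 ≤ m → (d : ℕ) →
    HasCount {n} (λ w → IsLength (m * n) (φ n m w) d) (RHS n m d)
theorem1p7 n@(suc n′) m 2≤n 2≤m d =
  hasCount-by-invariant (zero-codes-enumeration n′ m) NF code code-resp (λ {a} → code-NF {a}) d
                        (λ {a} → sound {a}) (λ {w} → complete {w})
  where
  instance
    m-nonZero : NonZero m
    m-nonZero = >-nonZero (≤-trans (s≤s z≤n) 2≤m)
  open Replication {m} 2≤n using (isLength-φ)
  open Codes 2≤n using (NF; code; code-resp; code-NF; code-HasZero; ~NF-code; size)
  sound : ∀ {a} → HasZero a → m * size a ≡ d → IsLength (m * n) (φ n m (NF a)) d
  sound {a} z refl = subst (λ b → IsLength (m * n) (φ n m (NF a)) (m * size b)) (code-NF {a} z) (isLength-φ (NF a))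
  complete : ∀ {w} → IsLength (m * n) (φ n m w) d → HasZero (code w) × m * size (code w) ≡ d × w ~ NF (code w)
  complete {w} ℓ = code-HasZero w , IsLength-unique (isLength-φ w) ℓ , ~NF-code w
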